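{- Let $k,h,q\ge 1$ be integers and fix a partition $\mathcal P=\{S_1,\ldots,S_M\}$ of $\{1,\ldots,k\}$. Then \[\sum_{\substack{d_1,\ldots,d_k\\ 1\leq d_i\leq h}}\Delta_{\mathcal P}(\mathcal D)\sum_{\mathcal Q\subseteq\{1,\ldots,k\}}(-1)^{|\mathcal Q|}\mathfrak S(\mathcal D_{\mathcal Q};q)=\sum_{\substack{d_1,\ldots,d_M\\ 1\leq d_i\leq h}}\ \sum_{\mathcal J\subseteq\{1,\ldots,M\}}\ \prod_{m\in\mathcal J}P_{|S_m|}\!\left(\frac{q}{\phi(q)}\right)\mathfrak S(\mathcal D_{\mathcal J};q),\] where on the left $\mathcal D=(d_1,\ldots,d_k)$ and on the right $\mathcal D=(d_1,\ldots,d_M)$.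
   Context: $\phi$ is Euler's totient function. For a tuple of integers $\mathcal D=(d_1,\ldots,d_t)$ (repetitions allowed) and a prime $p$, $\nu_p(\mathcal D)$ is the number of distinct residue classes mod $p$ occupied by its entries, and $\mathfrak S(\mathcal D;q)=\prod_{p\mid q}(1-\frac1p)^{ -t}(1-\frac{\nu_p(\mathcal D)}{p})$, with $\mathfrak S(\emptyset;q)=1$. For an index set $\mathcal J=\{j_1<\cdots<j_s\}$, $\mathcal D_{\mathcal J}=(d_{j_1},\ldots,d_{j_s})$. For a partition $\mathcal P$ of $\{1,\ldots,k\}$, $\Delta_{\mathcal P}(\mathcal D)=1$ if $d_i=d_j$ whenever $i,j$ lie in the same cell of $\mathcal P$, and $\Delta_{\mathcal P}(\mathcal D)=0$ otherwise. For an integer $\ell\ge1$, $P_\ell(z)=\frac{(1-z)^\ell-1}{z}=\sum_{j=1}^{\ell}\binom{\ell}{j}(-1)^j z^{j-1}$. -}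

module Defs where

open import Data.Nat as ℕ using (ℕ; zero; suc; _∸_; _%_; NonZero)
open import Data.Nat.Divisibility using (_∣?_)
open import Data.Nat.Primality using (prime?)
open import Data.Nat.Coprimality using (coprime?)
open import Data.Nat.Combinatorics using (_C_)
open import Data.Integer using (+_)
open import Data.Rational using (ℚ; 0ℚ; 1ℚ; _+_; _*_; _-_; -_; _/_)
open import Data.Fin using (Fin; zero; suc)
open import Data.Fin.Properties using (all?)
open import Data.Bool using (Bool; true; false; if_then_else_)
open import Data.List using (List; []; _∷_; upTo; map; filter; length; foldr)
open import Data.List.Relation.Unary.Any using (any?)
open import Data.Vec.Functional using () renaming (_∷_ to _∷ᶠ_)
open import Relation.Nullary.Decidable using (⌊_⌋; _→-dec_)
open import Relation.Binary.PropositionalEquality using (_≡_)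
open import Data.Fin.Properties as FinP using ()

infixr 8 _^_
_^_ : ℚ → ℕ → ℚ
x ^ zero  = 1ℚ
x ^ suc n = x * (x ^ n)

φ : ℕ → ℕ
φ q = length (filter (λ a → coprime? a q) (map suc (upTo q)))

ν : (p : ℕ) → .{{NonZero p}} → List ℕ → ℕ
ν p D = length (filter (λ r → any? (λ d → d % p ℕ.≟ r) D) (upTo p))

-- local factor at the prime p = 2 + m :  (1 - 1/p)^{-t} (1 - ν_p(D)/p),
-- written with (1 - 1/p)^{-1} = p/(p-1)
localFactor : ℕ → List ℕ → ℚ
localFactor m D =
  ((+ suc (suc m) / suc m) ^ length D)
    * (1ℚ - (+ ν (suc (suc m)) D / suc (suc m)))

-- singular series 𝔖(D;q) = ∏_{p ∣ q, p prime} (1-1/p)^{-t} (1 - ν_p(D)/p)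
-- (primes p ∣ q with q ≥ 1 satisfy 2 ≤ p ≤ q + 1; we run over p = 2+m, m < q)
𝔖 : List ℕ → ℕ → ℚ
𝔖 D q = foldr _*_ 1ℚ
  (map (λ m → localFactor m D)
    (filter (λ m → prime? (suc (suc m)) ×-dec' (suc (suc m) ∣? q)) (upTo q)))
  where
  open import Relation.Nullary.Decidable using () renaming (_×-dec_ to _×-dec'_)

-- q / φ(q) (φ(q) ≥ 1 whenever q ≥ 1; the value for φ(q) = 0 is irrelevant)
qOverφ : ℕ → ℚ
qOverφ q with φ q
... | zero  = 0ℚ
... | suc n = + q / suc n

sign : ℕ → ℚ
sign zero    = 1ℚ
sign (suc n) = - sign n

-- P_ℓ(z) = ((1-z)^ℓ - 1)/z = Σ_{j=1}^{ℓ} C(ℓ,j) (-1)^j z^{j-1}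
P : ℕ → ℚ → ℚ
P ℓ z = foldr _+_ 0ℚ
  (map (λ i → (+ (ℓ C suc i) / 1) * sign (suc i) * (z ^ i)) (upTo ℓ))

sumAll : ∀ {A : Set} (k : ℕ) → List A → ((Fin k → A) → ℚ) → ℚ
sumAll zero    vs f = f (λ ())
sumAll (suc k) vs f = foldr _+_ 0ℚ (map (λ a → sumAll k vs (λ g → f (a ∷ᶠ g))) vs)

sumTuples : (k h : ℕ) → ((Fin k → ℕ) → ℚ) → ℚ
sumTuples k h = sumAll k (map suc (upTo h))

sumSubsets : (k : ℕ) → ((Fin k → Bool) → ℚ) → ℚ
sumSubsets k = sumAll k (false ∷ true ∷ [])

-- D_J : entries of D with index in J, in increasing order of index
restrict : ∀ {A : Set} (k : ℕ) → (Fin k → Bool) → (Fin k → A) → List A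
restrict zero    J D = []
restrict (suc k) J D with J zero
... | true  = D zero ∷ restrict k (λ i → J (suc i)) (λ i → D (suc i))
... | false = restrict k (λ i → J (suc i)) (λ i → D (suc i))

card : (k : ℕ) → (Fin k → Bool) → ℕ
card k J = length (restrict k J J)

prodOver : (M : ℕ) → (Fin M → Bool) → (Fin M → ℚ) → ℚ
prodOver M J g = foldr _*_ 1ℚ (restrict M J g)

-- A partition {S_1,…,S_M} of {1,…,k} is encoded by its cell-labelling
-- c : Fin k → Fin M (i ∈ S_{c i}); cells are nonempty iff c is surjective.
IsSurjective : ∀ {k M} → (Fin k → Fin M) → Set
IsSurjective {k} {M} c = ∀ (m : Fin M) → Data.Product.∃ λ (i : Fin k) → c i ≡ m
  where import Data.Product

cellSize : ∀ {k M} → (Fin k → Fin M) → Fin M → ℕ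
cellSize {k} c m = length (filter (λ i → c i FinP.≟ m) (Data.List.allFin k))
  where import Data.List

Δ : ∀ {k M} → (Fin k → Fin M) → (Fin k → ℕ) → ℚ
Δ c d = if ⌊ all? (λ i → all? (λ j → (c i FinP.≟ c j) →-dec (d i ℕ.≟ d j))) ⌋
        then 1ℚ else 0ℚ

-- Write 𝔖(D;q) = (q/φ(q))^|D| U(D), where U(D) = ∏_{p ∣ q} (1 - ν_p(D)/p) depends only on the set
-- of entries of D; the identity q/φ(q) = ∏_{p ∣ q} p/(p-1) follows from φ(pr) = pφ(r) for p ∣ r and
-- φ(pr) = (p-1)φ(r) for p ∤ r. The tuples d with Δ_P(d) = 1 are exactly the d = e ∘ c for arbitrary
-- (e_1,…,e_M), and then a subset Q ⊆ {1,…,k} enters only through its image J ⊆ {1,…,M}. Grouping the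
-- weights (-q/φ(q))^|Q| by image, they multiply out over the cells to
-- ∏_{m ∈ J} ((1 - q/φ(q))^|S_m| - 1) = ∏_{m ∈ J} (q/φ(q)) P_|S_m|(q/φ(q)), which is the right-hand side.

module Submission where

open import Defs
open import Algebra.Bundles using (CommutativeMonoid; CommutativeSemigroup)
open import Algebra.Core using (Op₂)
open import Algebra.Structures using (IsCommutativeMonoid)
open import Data.Bool using (Bool; true; false; if_then_else_; _∧_; _∨_)
import Data.Bool.Properties as 𝔹P
open import Data.Empty using (⊥-elim)
open import Data.Fin as Fin using (Fin; zero; suc)
import Data.Fin.Properties as FinP
import Data.Integer as ℤ
import Data.Integer.Properties as ℤP
open import Data.List
  using (List; []; _∷_; map; foldr; upTo; applyUpTo; filter; length; tabulate; allFin)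
open import Data.List.Membership.Propositional using (_∈_; _∉_)
open import Data.List.Properties using (filter-≐; map-∘)
open import Data.List.Relation.Binary.Subset.Propositional using (_⊆_)
open import Data.List.Relation.Binary.Subset.Propositional.Properties using (Any-resp-⊆)
open import Data.List.Relation.Unary.All using (All; []; _∷_)
open import Data.List.Relation.Unary.All.Properties using (All¬⇒¬Any)
open import Data.List.Relation.Unary.AllPairs using (AllPairs; []; _∷_)
open import Data.List.Relation.Unary.Any using (here; there; any?)
import Data.List.Relation.Unary.Unique.Propositional.Properties as Unique
open import Data.Nat as ℕ using (ℕ; zero; suc; z≤n; s≤s; _≥_; NonZero)
open import Data.Nat.Combinatorics using (_C_; nCk+nC[k+1]≡[n+1]C[k+1]; k>n⇒nCk≡0)
open import Data.Nat.Coprimality as Coprimality using (Coprime; coprime?; coprime-divisor; coprime-+)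
open import Data.Nat.Divisibility
  using (_∣_; _∣?_; ∣-refl; ∣-trans; >⇒∤; ∣m∣n⇒∣m+n; ∣m+n∣m⇒∣n; ∣m⇒∣m*n; ∣n⇒∣m*n)
open import Data.Nat.ListAction using (product)
open import Data.Nat.Primality
  using (Prime; prime?; prime⇒irreducible; prime⇒nonTrivial; prime⇒nonZero; euclidsLemma; productOfPrimes≥1)
open import Data.Nat.Primality.Factorisation using (factorise; module PrimeFactorisation)
import Data.Nat.Properties as ℕP
open import Data.Nat.Solver using () renaming (module +-*-Solver to ℕSolver)
open import Data.Product using (∃; _×_; _,_; proj₁; proj₂)
open import Data.Rational using (ℚ; 0ℚ; 1ℚ; _+_; _*_; _-_; -_; _/_)
open import Data.Rational.Base using (toℚᵘ)
import Data.Rational.Properties as ℚP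
open import Data.Rational.Properties using (toℚᵘ-injective; toℚᵘ-homo-*; toℚᵘ-homo-+; toℚᵘ-fromℚᵘ)
open import Data.Rational.Solver using (module +-*-Solver)
import Data.Rational.Unnormalised as ℚᵘ
import Data.Rational.Unnormalised.Properties as ℚᵘP
open import Data.Sum using (_⊎_; inj₁; inj₂)
open import Data.Vec.Functional using () renaming (_∷_ to _∷ᶠ_)
open import Function using (_∘_; mk⇔)
open import Level using (0ℓ)
open import Relation.Binary using (DecidableEquality)
open import Relation.Binary.PropositionalEquality
open import Relation.Nullary using (Dec; yes; no; does; ¬_)
open import Relation.Nullary.Decidable
  using (dec-true; dec-false; does-⇔; isYes≗does; _→-dec_; _×-dec_)
open import Relation.Unary using (Pred; Decidable)

open import Algebra.Properties.CommutativeMonoid.Sum ℚP.*-1-commutativeMonoid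
  using () renaming (sum to ∏; sum-cong-≗ to ∏-cong)
open import Algebra.Properties.CommutativeSemigroup
  (CommutativeMonoid.commutativeSemigroup ℚP.*-1-commutativeMonoid)
  using (xy∙z≈xz∙y) renaming (xy∙z≈zy∙x to *-rotate)

module BigOperator {A : Set} {_∙_ : Op₂ A} {ε : A}
                   (isCM : IsCommutativeMonoid _≡_ _∙_ ε) where

  open IsCommutativeMonoid isCM using (assoc; comm; identityˡ; isCommutativeSemigroup)

  private
    commutativeSemigroup : CommutativeSemigroup 0ℓ 0ℓ
    commutativeSemigroup = record { isCommutativeSemigroup = isCommutativeSemigroup }

  open import Algebra.Properties.CommutativeSemigroup commutativeSemigroup using (interchange; xy∙z≈zy∙x)

  big : ℕ → (ℕ → A) → A
  big zero    f = ε
  big (suc n) f = f 0 ∙ big n (f ∘ suc)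

  big-cong< : ∀ n {f g : ℕ → A} → (∀ i → i ℕ.< n → f i ≡ g i) → big n f ≡ big n g
  big-cong< zero    eq = refl
  big-cong< (suc n) eq = cong₂ _∙_ (eq 0 (s≤s z≤n)) (big-cong< n (λ i i<n → eq (suc i) (s≤s i<n)))

  big-cong : ∀ n {f g : ℕ → A} → (∀ i → f i ≡ g i) → big n f ≡ big n g
  big-cong n eq = big-cong< n (λ i _ → eq i)

  big-distrib : ∀ n (f g : ℕ → A) → big n (λ i → f i ∙ g i) ≡ big n f ∙ big n g
  big-distrib zero    f g = sym (identityˡ ε)
  big-distrib (suc n) f g = trans (cong (_ ∙_) (big-distrib n _ _)) (interchange _ _ _ _)

  big-identity : ∀ n → big n (λ _ → ε) ≡ ε
  big-identity zero    = refl
  big-identity (suc n) = trans (identityˡ _) (big-identity n)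

  big-+ : ∀ a b (f : ℕ → A) → big (a ℕ.+ b) f ≡ big a f ∙ big b (λ i → f (a ℕ.+ i))
  big-+ zero    b f = sym (identityˡ _)
  big-+ (suc a) b f = trans (cong (f 0 ∙_) (big-+ a b _)) (sym (assoc _ _ _))

  big-snoc : ∀ n (f : ℕ → A) → big (suc n) f ≡ big n f ∙ f n
  big-snoc zero    f = comm (f 0) ε
  big-snoc (suc n) f = trans (cong (f 0 ∙_) (big-snoc n (f ∘ suc))) (sym (assoc _ _ _))

  big-update : ∀ n j (f g : ℕ → A) → j ℕ.< n → (∀ i → i ≢ j → f i ≡ g i) →
               big n f ∙ g j ≡ big n g ∙ f j
  big-update (suc n) zero    f g _ eq =
    trans (cong (λ z → (f 0 ∙ z) ∙ g 0) (big-cong n (λ i → eq (suc i) (λ ()))))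
          (xy∙z≈zy∙x _ _ _)
  big-update (suc n) (suc j) f g (s≤s j<n) eq =
    trans (assoc _ _ _)
      (trans (cong₂ _∙_ (eq 0 (λ ()))
                        (big-update n j _ _ j<n (λ i i≢j → eq (suc i) (i≢j ∘ ℕP.suc-injective))))
             (sym (assoc _ _ _)))

  foldr-upTo : ∀ n (f : ℕ → A) → foldr _∙_ ε (map f (upTo n)) ≡ big n f
  foldr-upTo n f = go n (λ i → i)
    where
    go : ∀ n (g : ℕ → ℕ) → foldr _∙_ ε (map f (applyUpTo g n)) ≡ big n (f ∘ g)
    go zero    g = refl
    go (suc n) g = cong (f (g 0) ∙_) (go n (g ∘ suc))

  foldr-filter : ∀ {B : Set} {ℓ} {P : Pred B ℓ} (P? : Decidable P) (xs : List B) (f : B → A) →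
                 foldr _∙_ ε (map f (filter P? xs))
                   ≡ foldr _∙_ ε (map (λ x → if does (P? x) then f x else ε) xs)
  foldr-filter P? []       f = refl
  foldr-filter P? (x ∷ xs) f with does (P? x)
  ... | true  = cong (f x ∙_) (foldr-filter P? xs f)
  ... | false = trans (foldr-filter P? xs f) (sym (identityˡ _))

  foldr-distrib : ∀ {B : Set} (xs : List B) (f g : B → A) →
                  foldr _∙_ ε (map (λ x → f x ∙ g x) xs)
                    ≡ foldr _∙_ ε (map f xs) ∙ foldr _∙_ ε (map g xs)
  foldr-distrib []       f g = sym (identityˡ ε)
  foldr-distrib (x ∷ xs) f g = trans (cong (_ ∙_) (foldr-distrib xs f g)) (interchange _ _ _ _)

  foldr-cong : ∀ {B : Set} (xs : List B) {f g : B → A} → (∀ x → f x ≡ g x) →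
               foldr _∙_ ε (map f xs) ≡ foldr _∙_ ε (map g xs)
  foldr-cong []       eq = refl
  foldr-cong (x ∷ xs) eq = cong₂ _∙_ (eq x) (foldr-cong xs eq)

module Sumℚ = BigOperator ℚP.+-0-isCommutativeMonoid
module Prodℚ = BigOperator ℚP.*-1-isCommutativeMonoid

∏-update : ∀ {M} (j : Fin M) (f g : Fin M → ℚ) → (∀ i → i ≢ j → f i ≡ g i) →
           ∏ f * g j ≡ ∏ g * f j
∏-update zero    f g eq =
  trans (cong (λ z → (f zero * z) * g zero)
              (∏-cong {x = f ∘ suc} {y = g ∘ suc} (λ i → eq (suc i) (λ ()))))
        (*-rotate (f zero) (∏ (g ∘ suc)) (g zero))
∏-update (suc j) f g eq =
  trans (ℚP.*-assoc (f zero) (∏ (f ∘ suc)) (g (suc j)))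
    (trans (cong₂ _*_ (eq zero (λ ()))
                      (∏-update j _ _ (λ i i≢j → eq (suc i) (i≢j ∘ FinP.suc-injective))))
           (sym (ℚP.*-assoc (g zero) (∏ (g ∘ suc)) (f (suc j)))))

∏-except : ∀ {M} → Fin M → (Fin M → ℚ) → ℚ
∏-except j f = ∏ (λ m → if does (j Fin.≟ m) then 1ℚ else f m)

∏-except-cong : ∀ {M} (j : Fin M) {f g : Fin M → ℚ} → (∀ m → m ≢ j → f m ≡ g m) →
                ∏-except j f ≡ ∏-except j g
∏-except-cong j {f} {g} eq = ∏-cong pointwise
  where
  pointwise : ∀ m → (if does (j Fin.≟ m) then 1ℚ else f m) ≡ (if does (j Fin.≟ m) then 1ℚ else g m)
  pointwise m with j Fin.≟ m
  ... | yes _   = refl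
  ... | no j≢m  = eq m (j≢m ∘ sym)

∏-split : ∀ {M} (j : Fin M) (f : Fin M → ℚ) → ∏ f ≡ ∏-except j f * f j
∏-split j f = begin
  ∏ f                     ≡⟨ sym (ℚP.*-identityʳ (∏ f)) ⟩
  ∏ f * 1ℚ                ≡⟨ cong (λ b → ∏ f * (if b then 1ℚ else f j))
                                  (sym (dec-true (j Fin.≟ j) refl)) ⟩
  ∏ f * f-except-j j      ≡⟨ ∏-update j f f-except-j off-j ⟩
  ∏-except j f * f j      ∎
  where
  open ≡-Reasoning
  f-except-j = λ m → if does (j Fin.≟ m) then 1ℚ else f m
  off-j : ∀ m → m ≢ j → f m ≡ (if does (j Fin.≟ m) then 1ℚ else f m)
  off-j m m≢j = cong (λ b → if b then 1ℚ else f m) (sym (dec-false (j Fin.≟ m) (m≢j ∘ sym)))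

∏-split-agreeing : ∀ {M} (j : Fin M) (f g : Fin M → ℚ) → (∀ m → m ≢ j → f m ≡ g m) →
                   ∏ g ≡ ∏-except j f * g j
∏-split-agreeing j f g eq = trans (∏-split j g) (cong (_* g j) (sym (∏-except-cong j eq)))

∏-zero : ∀ {M} (j : Fin M) (f : Fin M → ℚ) → f j ≡ 0ℚ → ∏ f ≡ 0ℚ
∏-zero j f fj≡0 =
  trans (∏-split j f) (trans (cong (∏-except j f *_) fj≡0) (ℚP.*-zeroʳ (∏-except j f)))

∏-one : ∀ {M} (f : Fin M → ℚ) → (∀ m → f m ≡ 1ℚ) → ∏ f ≡ 1ℚ
∏-one {zero}  f eq = refl
∏-one {suc M} f eq = trans (cong₂ _*_ (eq zero) (∏-one (f ∘ suc) (eq ∘ suc))) (ℚP.*-identityˡ 1ℚ)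

sumOver : ∀ {A : Set} → List A → (A → ℚ) → ℚ
sumOver vs f = foldr _+_ 0ℚ (map f vs)

sumOver-cong∈ : ∀ {A : Set} (vs : List A) {f g : A → ℚ} → (∀ a → a ∈ vs → f a ≡ g a) →
                sumOver vs f ≡ sumOver vs g
sumOver-cong∈ []       eq = refl
sumOver-cong∈ (x ∷ vs) eq = cong₂ _+_ (eq x (here refl)) (sumOver-cong∈ vs (λ a a∈ → eq a (there a∈)))

sumOver-*ˡ : ∀ {A : Set} (vs : List A) (a : ℚ) (f : A → ℚ) →
             a * sumOver vs f ≡ sumOver vs (λ x → a * f x)
sumOver-*ˡ []       a f = ℚP.*-zeroʳ a
sumOver-*ˡ (x ∷ vs) a f = trans (ℚP.*-distribˡ-+ a (f x) _) (cong (a * f x +_) (sumOver-*ˡ vs a f))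

sumOver-zero : ∀ {A : Set} (vs : List A) → sumOver vs (λ _ → 0ℚ) ≡ 0ℚ
sumOver-zero []       = refl
sumOver-zero (x ∷ vs) = trans (ℚP.+-identityˡ _) (sumOver-zero vs)

sumOver-comm : ∀ {A B : Set} (vs : List A) (ws : List B) (F : A → B → ℚ) →
               sumOver vs (λ a → sumOver ws (F a)) ≡ sumOver ws (λ b → sumOver vs (λ a → F a b))
sumOver-comm []       ws F = sym (sumOver-zero ws)
sumOver-comm (x ∷ vs) ws F =
  trans (cong (sumOver ws (F x) +_) (sumOver-comm vs ws F))
        (sym (Sumℚ.foldr-distrib ws (F x) (λ b → sumOver vs (λ a → F a b))))

sumAll-cong∈ : ∀ {A : Set} k (vs : List A) {f g : (Fin k → A) → ℚ} →
               (∀ d → (∀ i → d i ∈ vs) → f d ≡ g d) → sumAll k vs f ≡ sumAll k vs g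
sumAll-cong∈ zero    vs eq = eq _ (λ ())
sumAll-cong∈ (suc k) vs eq =
  sumOver-cong∈ vs (λ a a∈ → sumAll-cong∈ k vs (λ d d∈ →
    eq (a ∷ᶠ d) (λ { zero → a∈ ; (suc i) → d∈ i })))

sumAll-cong : ∀ {A : Set} k (vs : List A) {f g : (Fin k → A) → ℚ} →
              (∀ d → f d ≡ g d) → sumAll k vs f ≡ sumAll k vs g
sumAll-cong k vs eq = sumAll-cong∈ k vs (λ d _ → eq d)

sumAll-*ˡ : ∀ {A : Set} k (vs : List A) (a : ℚ) (f : (Fin k → A) → ℚ) →
            a * sumAll k vs f ≡ sumAll k vs (λ d → a * f d)
sumAll-*ˡ zero    vs a f = refl
sumAll-*ˡ (suc k) vs a f = trans (sumOver-*ˡ vs a _) (sumOver-cong∈ vs (λ x _ → sumAll-*ˡ k vs a _))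

sumAll-+ : ∀ {A : Set} k (vs : List A) (f g : (Fin k → A) → ℚ) →
           sumAll k vs (λ d → f d + g d) ≡ sumAll k vs f + sumAll k vs g
sumAll-+ zero    vs f g = refl
sumAll-+ (suc k) vs f g =
  trans (sumOver-cong∈ vs (λ x _ → sumAll-+ k vs _ _)) (Sumℚ.foldr-distrib vs _ _)

sumAll-zero : ∀ {A : Set} k (vs : List A) → sumAll k vs (λ _ → 0ℚ) ≡ 0ℚ
sumAll-zero zero    vs = refl
sumAll-zero (suc k) vs = trans (sumOver-cong∈ vs (λ x _ → sumAll-zero k vs)) (sumOver-zero vs)

sumOver-sumAll-comm : ∀ {A B : Set} M (vs : List A) (ws : List B) (G : A → (Fin M → B) → ℚ) →
                      sumOver vs (λ a → sumAll M ws (G a)) ≡ sumAll M ws (λ e → sumOver vs (λ a → G a e))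
sumOver-sumAll-comm zero    vs ws G = refl
sumOver-sumAll-comm (suc M) vs ws G =
  trans (sumOver-comm vs ws _)
        (sumOver-cong∈ ws (λ b _ → sumOver-sumAll-comm M vs ws (λ a g → G a (b ∷ᶠ g))))

sumAll-comm : ∀ {A B : Set} k M (vs : List A) (ws : List B)
              (F : (Fin k → A) → (Fin M → B) → ℚ) →
              sumAll k vs (λ d → sumAll M ws (F d)) ≡ sumAll M ws (λ e → sumAll k vs (λ d → F d e))
sumAll-comm zero    M vs ws F = refl
sumAll-comm (suc k) M vs ws F =
  trans (sumOver-cong∈ vs (λ a _ → sumAll-comm k M vs ws (λ d e → F (a ∷ᶠ d) e)))
        (sumOver-sumAll-comm M vs ws _)

module KroneckerDelta {A : Set} (_≟_ : DecidableEquality A) where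

  δ : A → A → ℚ
  δ a b = if does (a ≟ b) then 1ℚ else 0ℚ

  δ-refl : ∀ a → δ a a ≡ 1ℚ
  δ-refl a = cong (λ b → if b then 1ℚ else 0ℚ) (dec-true (a ≟ a) refl)

  δ-≢ : ∀ {a b} → a ≢ b → δ a b ≡ 0ℚ
  δ-≢ {a} {b} a≢b = cong (λ b → if b then 1ℚ else 0ℚ) (dec-false (a ≟ b) a≢b)

  ⟦_≗_⟧ : ∀ {k} → (Fin k → A) → (Fin k → A) → ℚ
  ⟦ d ≗ g ⟧ = ∏ (λ i → δ (d i) (g i))

  ⟦≗⟧-agree : ∀ {k} {d g : Fin k → A} → (∀ i → d i ≡ g i) → ⟦ d ≗ g ⟧ ≡ 1ℚ
  ⟦≗⟧-agree {d = d} {g} d≗g =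
    ∏-one (λ i → δ (d i) (g i)) (λ i → trans (cong (λ a → δ a (g i)) (d≗g i)) (δ-refl (g i)))

  ⟦≗⟧-disagree : ∀ {k} {d g : Fin k → A} → ¬ (∀ i → d i ≡ g i) → ⟦ d ≗ g ⟧ ≡ 0ℚ
  ⟦≗⟧-disagree {k} {d} {g} d≉g with FinP.¬∀⟶∃¬ k _ (λ i → d i ≟ g i) d≉g
  ... | i , di≢gi = ∏-zero i (λ i → δ (d i) (g i)) (δ-≢ di≢gi)

  ⟦≗⟧-⇔ : ∀ {k l} {d g : Fin k → A} {d′ g′ : Fin l → A} →
          ((∀ i → d i ≡ g i) → (∀ i → d′ i ≡ g′ i)) →
          ((∀ i → d′ i ≡ g′ i) → (∀ i → d i ≡ g i)) →
          ⟦ d ≗ g ⟧ ≡ ⟦ d′ ≗ g′ ⟧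
  ⟦≗⟧-⇔ {d = d} {g} to from with FinP.all? (λ i → d i ≟ g i)
  ... | yes d≗g = trans (⟦≗⟧-agree d≗g) (sym (⟦≗⟧-agree (to d≗g)))
  ... | no  d≉g = trans (⟦≗⟧-disagree d≉g) (sym (⟦≗⟧-disagree (d≉g ∘ from)))

  sumOver-δ-∉ : ∀ (vs : List A) b (X : A → ℚ) → b ∉ vs → sumOver vs (λ a → δ a b * X a) ≡ 0ℚ
  sumOver-δ-∉ []       b X _   = refl
  sumOver-δ-∉ (x ∷ vs) b X b∉ =
    trans (cong₂ _+_ (trans (cong (_* X x) (δ-≢ (b∉ ∘ here ∘ sym))) (ℚP.*-zeroˡ (X x)))
                     (sumOver-δ-∉ vs b X (b∉ ∘ there)))
          (ℚP.+-identityˡ 0ℚ)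

  sumOver-δ : ∀ (vs : List A) b (X : A → ℚ) → AllPairs _≢_ vs → b ∈ vs →
              sumOver vs (λ a → δ a b * X a) ≡ X b
  sumOver-δ (x ∷ vs) b X (x∉ ∷ _) (here refl) =
    trans (cong₂ _+_ (trans (cong (_* X x) (δ-refl x)) (ℚP.*-identityˡ (X x)))
                     (sumOver-δ-∉ vs x X (All¬⇒¬Any x∉)))
          (ℚP.+-identityʳ (X x))
  sumOver-δ (x ∷ vs) b X (x∉ ∷ distinct) (there b∈) =
    trans (cong₂ _+_ (trans (cong (_* X x) (δ-≢ λ { refl → All¬⇒¬Any x∉ b∈ })) (ℚP.*-zeroˡ (X x)))
                     (sumOver-δ vs b X distinct b∈))
          (ℚP.+-identityˡ (X b))

  sumAll-⟦≗⟧ : ∀ k (vs : List A) (g : Fin k → A) (W : (Fin k → A) → ℚ) →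
               AllPairs _≢_ vs → (∀ i → g i ∈ vs) →
               (∀ {d d′} → (∀ i → d i ≡ d′ i) → W d ≡ W d′) →
               sumAll k vs (λ d → ⟦ d ≗ g ⟧ * W d) ≡ W g
  sumAll-⟦≗⟧ zero    vs g W _ _ W-resp = trans (ℚP.*-identityˡ _) (W-resp (λ ()))
  sumAll-⟦≗⟧ (suc k) vs g W distinct g∈ W-resp = begin
    sumOver vs (λ a → sumAll k vs (λ d → (δ a g₀ * ⟦ d ≗ g′ ⟧) * W (a ∷ᶠ d)))
      ≡⟨ sumOver-cong∈ vs (λ a _ → pull a) ⟩
    sumOver vs (λ a → δ a g₀ * sumAll k vs (λ d → ⟦ d ≗ g′ ⟧ * W (a ∷ᶠ d)))
      ≡⟨ sumOver-cong∈ vs (λ a _ → cong (δ a g₀ *_) (collapse a)) ⟩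
    sumOver vs (λ a → δ a g₀ * W (a ∷ᶠ g′))
      ≡⟨ sumOver-δ vs g₀ (λ a → W (a ∷ᶠ g′)) distinct (g∈ zero) ⟩
    W (g₀ ∷ᶠ g′)
      ≡⟨ W-resp (λ { zero → refl ; (suc i) → refl }) ⟩
    W g ∎
    where
    open ≡-Reasoning
    g₀ = g zero
    g′ = g ∘ suc
    collapse : ∀ a → sumAll k vs (λ d → ⟦ d ≗ g′ ⟧ * W (a ∷ᶠ d)) ≡ W (a ∷ᶠ g′)
    collapse a = sumAll-⟦≗⟧ k vs g′ (W ∘ (a ∷ᶠ_)) distinct (g∈ ∘ suc)
                   (λ d≗d′ → W-resp (λ { zero → refl ; (suc i) → d≗d′ i }))
    pull : ∀ a → sumAll k vs (λ d → (δ a g₀ * ⟦ d ≗ g′ ⟧) * W (a ∷ᶠ d))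
                 ≡ δ a g₀ * sumAll k vs (λ d → ⟦ d ≗ g′ ⟧ * W (a ∷ᶠ d))
    pull a = trans (sumAll-cong k vs (λ d → ℚP.*-assoc (δ a g₀) ⟦ d ≗ g′ ⟧ (W (a ∷ᶠ d))))
                   (sym (sumAll-*ˡ k vs (δ a g₀) _))

module PartitionReindexing where

  open KroneckerDelta ℕ._≟_

  ConstantOnCells : ∀ {k M} → (Fin k → Fin M) → (Fin k → ℕ) → Set
  ConstantOnCells c d = ∀ i j → c i ≡ c j → d i ≡ d j

  private
    constantOnCells? : ∀ {k M} (c : Fin k → Fin M) d → Dec (ConstantOnCells c d)
    constantOnCells? c d = FinP.all? (λ i → FinP.all? (λ j → (c i Fin.≟ c j) →-dec (d i ℕ.≟ d j)))

    Δ≡if : ∀ {k M} (c : Fin k → Fin M) d → Δ c d ≡ (if does (constantOnCells? c d) then 1ℚ else 0ℚ)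
    Δ≡if c d = cong (λ b → if b then 1ℚ else 0ℚ) (isYes≗does (constantOnCells? c d))

  Δ-constant : ∀ {k M} (c : Fin k → Fin M) d → ConstantOnCells c d → Δ c d ≡ 1ℚ
  Δ-constant c d const =
    trans (Δ≡if c d) (cong (λ b → if b then 1ℚ else 0ℚ) (dec-true (constantOnCells? c d) const))

  Δ-nonconstant : ∀ {k M} (c : Fin k → Fin M) d → ¬ ConstantOnCells c d → Δ c d ≡ 0ℚ
  Δ-nonconstant c d ¬const =
    trans (Δ≡if c d) (cong (λ b → if b then 1ℚ else 0ℚ) (dec-false (constantOnCells? c d) ¬const))

  -- A tuple constant on the cells is e ∘ c for exactly one e, namely d ∘ section.
  Δ≡sumAll-⟦≗⟧ : ∀ {k M} (c : Fin k → Fin M) → IsSurjective c →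
                 (vs : List ℕ) → AllPairs _≢_ vs →
                 ∀ d → (∀ i → d i ∈ vs) → Δ c d ≡ sumAll M vs (λ e → ⟦ d ≗ e ∘ c ⟧)
  Δ≡sumAll-⟦≗⟧ {k} {M} c surj vs distinct d d∈ with constantOnCells? c d
  ... | no ¬const = trans (Δ-nonconstant c d ¬const)
    (sym (trans (sumAll-cong M vs (λ e → ⟦≗⟧-disagree (λ d≗ec → ¬const
                   (λ i j ci≡cj → trans (d≗ec i) (trans (cong e ci≡cj) (sym (d≗ec j)))))))
                (sumAll-zero M vs)))
  ... | yes const = trans (Δ-constant c d const)
    (sym (trans (sumAll-cong M vs (λ e → trans (⟦≗⟧-⇔ (to e) (from e))
                                               (sym (ℚP.*-identityʳ ⟦ e ≗ d∘section ⟧))))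
                (sumAll-⟦≗⟧ M vs d∘section (λ _ → 1ℚ) distinct (d∈ ∘ section) (λ _ → refl))))
    where
    section : Fin M → Fin k
    section m = proj₁ (surj m)
    d∘section : Fin M → ℕ
    d∘section = d ∘ section
    to : ∀ e → (∀ i → d i ≡ e (c i)) → ∀ m → e m ≡ d∘section m
    to e d≗ec m = trans (cong e (sym (proj₂ (surj m)))) (sym (d≗ec (section m)))
    from : ∀ e → (∀ m → e m ≡ d∘section m) → ∀ i → d i ≡ e (c i)
    from e e≗ds i = trans (const i (section (c i)) (sym (proj₂ (surj (c i))))) (sym (e≗ds (c i)))

  sumTuples-Δ : ∀ {k M} (c : Fin k → Fin M) → IsSurjective c → ∀ h (F : (Fin k → ℕ) → ℚ) →
                (∀ {d d′} → (∀ i → d i ≡ d′ i) → F d ≡ F d′) →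
                sumTuples k h (λ d → Δ c d * F d) ≡ sumTuples M h (λ e → F (e ∘ c))
  sumTuples-Δ {k} {M} c surj h F F-resp = begin
    sumAll k vs (λ d → Δ c d * F d)
      ≡⟨ sumAll-cong∈ k vs (λ d d∈ →
           trans (cong (_* F d) (Δ≡sumAll-⟦≗⟧ c surj vs distinct d d∈)) (sumAll-*ʳ (F d))) ⟩
    sumAll k vs (λ d → sumAll M vs (λ e → ⟦ d ≗ e ∘ c ⟧ * F d))
      ≡⟨ sumAll-comm k M vs vs (λ d e → ⟦ d ≗ e ∘ c ⟧ * F d) ⟩
    sumAll M vs (λ e → sumAll k vs (λ d → ⟦ d ≗ e ∘ c ⟧ * F d))
      ≡⟨ sumAll-cong∈ M vs (λ e e∈ → sumAll-⟦≗⟧ k vs (e ∘ c) F distinct (e∈ ∘ c) F-resp) ⟩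
    sumAll M vs (λ e → F (e ∘ c)) ∎
    where
    open ≡-Reasoning
    vs = map suc (upTo h)
    distinct : AllPairs _≢_ vs
    distinct = Unique.map⁺ ℕP.suc-injective (Unique.upTo⁺ h)
    sumAll-*ʳ : ∀ {G : (Fin M → ℕ) → ℚ} a → sumAll M vs G * a ≡ sumAll M vs (λ e → G e * a)
    sumAll-*ʳ {G} a = trans (ℚP.*-comm (sumAll M vs G) a)
                            (trans (sumAll-*ˡ M vs a G) (sumAll-cong M vs (λ e → ℚP.*-comm a (G e))))

open KroneckerDelta 𝔹P._≟_

bools : List Bool
bools = false ∷ true ∷ []

bools-distinct : AllPairs _≢_ bools
bools-distinct = ((λ ()) ∷ []) ∷ [] ∷ []

image : ∀ {k M} → (Fin k → Fin M) → (Fin k → Bool) → Fin M → Bool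
image {zero}  c Q m = false
image {suc k} c Q m = (Q zero ∧ does (c zero Fin.≟ m)) ∨ image (c ∘ suc) (Q ∘ suc) m

insert : ∀ {M} → Fin M → (Fin M → Bool) → Fin M → Bool
insert j I m = does (j Fin.≟ m) ∨ I m

erase : ∀ {M} → Fin M → (Fin M → Bool) → Fin M → Bool
erase j J m = if does (j Fin.≟ m) then false else J m

erase-here : ∀ {M} (j : Fin M) J → erase j J j ≡ false
erase-here j J = cong (λ b → if b then false else J j) (dec-true (j Fin.≟ j) refl)

erase-there : ∀ {M} {j m : Fin M} J → m ≢ j → erase j J m ≡ J m
erase-there {j = j} {m} J m≢j =
  cong (λ b → if b then false else J m) (dec-false (j Fin.≟ m) (m≢j ∘ sym))

insert-there : ∀ {M} {j m : Fin M} I → m ≢ j → insert j I m ≡ I m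
insert-there {j = j} {m} I m≢j = cong (_∨ I m) (dec-false (j Fin.≟ m) (m≢j ∘ sym))

⟦≗⟧-insert : ∀ {M} (j : Fin M) (J I : Fin M → Bool) →
             ⟦ J ≗ insert j I ⟧ ≡ (if J j then ⟦ J ≗ I ⟧ + ⟦ erase j J ≗ I ⟧ else 0ℚ)
⟦≗⟧-insert j J I = begin
  ⟦ J ≗ insert j I ⟧
    ≡⟨ ∏-split j f ⟩
  R * δ (J j) (insert j I j)
    ≡⟨ cong (λ b → R * δ (J j) (b ∨ I j)) (dec-true (j Fin.≟ j) refl) ⟩
  R * δ (J j) true
    ≡⟨ split-on (J j) ⟩
  (if J j then R * δ (J j) (I j) + R * δ false (I j) else 0ℚ)
    ≡⟨ cong (λ z → if J j then z else 0ℚ) (sym (cong₂ _+_ J-split erase-split)) ⟩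
  (if J j then ⟦ J ≗ I ⟧ + ⟦ erase j J ≗ I ⟧ else 0ℚ) ∎
  where
  open ≡-Reasoning
  f = λ m → δ (J m) (insert j I m)
  R = ∏-except j f
  δ-partition : ∀ b → δ true b + δ false b ≡ 1ℚ
  δ-partition true  = ℚP.+-identityʳ 1ℚ
  δ-partition false = ℚP.+-identityˡ 1ℚ
  split-on : ∀ b → R * δ b true ≡ (if b then R * δ b (I j) + R * δ false (I j) else 0ℚ)
  split-on true  = trans (cong (R *_) (sym (δ-partition (I j)))) (ℚP.*-distribˡ-+ R _ _)
  split-on false = ℚP.*-zeroʳ R
  J-split : ⟦ J ≗ I ⟧ ≡ R * δ (J j) (I j)
  J-split = ∏-split-agreeing j f (λ m → δ (J m) (I m))
              (λ m m≢j → cong (δ (J m)) (insert-there I m≢j))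
  erase-split : ⟦ erase j J ≗ I ⟧ ≡ R * δ false (I j)
  erase-split = trans (∏-split-agreeing j f (λ m → δ (erase j J m) (I m))
                         (λ m m≢j → trans (cong (δ (J m)) (insert-there I m≢j))
                                          (cong (λ b → δ b (I m)) (sym (erase-there J m≢j)))))
                      (cong (λ b → R * δ b (I j)) (erase-here j J))

length-filter-tabulate : ∀ {n} {A : Set} {ℓ} {P : Pred A ℓ} (P? : Decidable P) (h : Fin n → A) →
                         length (filter P? (tabulate h)) ≡ length (filter (P? ∘ h) (allFin n))
length-filter-tabulate {zero}  P? h = refl
length-filter-tabulate {suc n} P? h with does (P? (h zero))
... | true  = cong suc (trans (length-filter-tabulate P? (h ∘ suc))
                              (sym (length-filter-tabulate (P? ∘ h) suc)))
... | false = trans (length-filter-tabulate P? (h ∘ suc))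
                    (sym (length-filter-tabulate (P? ∘ h) suc))

cellSize-suc : ∀ {k M} (c : Fin (suc k) → Fin M) m →
               cellSize c m ≡ (if does (c zero Fin.≟ m) then 1 else 0) ℕ.+ cellSize (c ∘ suc) m
cellSize-suc c m with does (c zero Fin.≟ m)
... | true  = cong suc (length-filter-tabulate (λ i → c i Fin.≟ m) suc)
... | false = length-filter-tabulate (λ i → c i Fin.≟ m) suc

cellFactor : ℚ → Bool → ℕ → ℚ
cellFactor x true  s = (1ℚ + x) ^ s - 1ℚ
cellFactor x false s = 1ℚ

cellFactor-suc : ∀ x b s R → R * cellFactor x b (suc s)
                 ≡ R * cellFactor x b s + (if b then x * (R * cellFactor x b s + R * 1ℚ) else 0ℚ)
cellFactor-suc x false s R = sym (ℚP.+-identityʳ (R * 1ℚ))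
cellFactor-suc x true  s R = identity R ((1ℚ + x) ^ s) x
  where
  open +-*-Solver
  identity : ∀ R t x → R * ((1ℚ + x) * t - 1ℚ) ≡ R * (t - 1ℚ) + x * (R * (t - 1ℚ) + R * 1ℚ)
  identity = solve 3 (λ R t x → R :* ((con 1ℚ :+ x) :* t :- con 1ℚ)
                                := R :* (t :- con 1ℚ) :+ x :* (R :* (t :- con 1ℚ) :+ R :* con 1ℚ)) refl

imageWeight : ∀ {k M} → ℚ → (Fin k → Fin M) → (Fin M → Bool) → ℚ
imageWeight {k} x c J = sumSubsets k (λ Q → ⟦ J ≗ image c Q ⟧ * x ^ card k Q)

-- Q either avoids 0, or Q = {0} ∪ Q′ and then image c Q = insert (c zero) (image (c ∘ suc) Q′).
imageWeight-suc : ∀ {k M} x (c : Fin (suc k) → Fin M) J →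
                  imageWeight x c J
                    ≡ imageWeight x (c ∘ suc) J
                      + (if J (c zero)
                         then x * (imageWeight x (c ∘ suc) J + imageWeight x (c ∘ suc) (erase (c zero) J))
                         else 0ℚ)
imageWeight-suc {k} x c J =
  cong (W J +_)
    (trans (ℚP.+-identityʳ _)
      (trans (sumAll-cong k bools (λ Q → cong (_* (x * x ^ card k Q)) (⟦≗⟧-insert c₀ J (image c′ Q))))
             (weigh (J c₀))))
  where
  c₀ = c zero
  c′ = c ∘ suc
  J′ = erase c₀ J
  W = imageWeight x c′
  weight = λ (K : Fin _ → Bool) Q → ⟦ K ≗ image c′ Q ⟧
  term = λ K Q → x * (weight K Q * x ^ card k Q)
  weigh : ∀ b → sumAll k bools (λ Q → (if b then weight J Q + weight J′ Q else 0ℚ) * (x * x ^ card k Q))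
                ≡ (if b then x * (W J + W J′) else 0ℚ)
  weigh false = trans (sumAll-cong k bools (λ Q → ℚP.*-zeroˡ (x * x ^ card k Q))) (sumAll-zero k bools)
  weigh true  = begin
    sumAll k bools (λ Q → (weight J Q + weight J′ Q) * (x * x ^ card k Q))
      ≡⟨ sumAll-cong k bools (λ Q → distribute (weight J Q) (weight J′ Q) x (x ^ card k Q)) ⟩
    sumAll k bools (λ Q → term J Q + term J′ Q)
      ≡⟨ sumAll-+ k bools (term J) (term J′) ⟩
    sumAll k bools (term J) + sumAll k bools (term J′)
      ≡⟨ sym (cong₂ _+_ (sumAll-*ˡ k bools x _) (sumAll-*ˡ k bools x _)) ⟩
    x * W J + x * W J′
      ≡⟨ sym (ℚP.*-distribˡ-+ x (W J) (W J′)) ⟩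
    x * (W J + W J′) ∎
    where
    open ≡-Reasoning
    open +-*-Solver
    distribute : ∀ a b x t → (a + b) * (x * t) ≡ x * (a * t) + x * (b * t)
    distribute = solve 4 (λ a b x t → (a :+ b) :* (x :* t) := x :* (a :* t) :+ x :* (b :* t)) refl

imageWeight≡∏ : ∀ {k M} x (c : Fin k → Fin M) J →
                imageWeight x c J ≡ ∏ (λ m → cellFactor x (J m) (cellSize c m))
imageWeight≡∏ {zero} x c J =
  trans (ℚP.*-identityʳ _) (∏-cong {x = λ m → δ (J m) false} (λ m → empty (J m)))
  where
  empty : ∀ b → δ b false ≡ cellFactor x b 0
  empty true  = sym (ℚP.+-inverseʳ 1ℚ)
  empty false = refl
imageWeight≡∏ {suc k} x c J = begin
  imageWeight x c J
    ≡⟨ imageWeight-suc x c J ⟩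
  imageWeight x c′ J + (if J c₀ then x * (imageWeight x c′ J + imageWeight x c′ (erase c₀ J)) else 0ℚ)
    ≡⟨ cong₂ (λ a b → a + (if J c₀ then x * (a + b) else 0ℚ)) without-c₀ without-c₀-erased ⟩
  R * cellFactor x (J c₀) s + (if J c₀ then x * (R * cellFactor x (J c₀) s + R * 1ℚ) else 0ℚ)
    ≡⟨ sym (cellFactor-suc x (J c₀) s R) ⟩
  R * cellFactor x (J c₀) (suc s)
    ≡⟨ cong (λ n → R * cellFactor x (J c₀) n) (sym cellSize-c₀) ⟩
  R * cellFactors c J c₀
    ≡⟨ sym (∏-split c₀ (cellFactors c J)) ⟩
  ∏ (cellFactors c J) ∎
  where
  open ≡-Reasoning
  c₀ = c zero
  c′ = c ∘ suc
  s = cellSize c′ c₀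
  cellFactors : ∀ {k} → (Fin k → Fin _) → (Fin _ → Bool) → Fin _ → ℚ
  cellFactors c J m = cellFactor x (J m) (cellSize c m)
  R = ∏-except c₀ (cellFactors c J)
  cellSize-c₀ : cellSize c c₀ ≡ suc s
  cellSize-c₀ = trans (cellSize-suc c c₀)
                      (cong (λ b → (if b then 1 else 0) ℕ.+ s) (dec-true (c₀ Fin.≟ c₀) refl))
  cellSize-off : ∀ {m} → m ≢ c₀ → cellSize c m ≡ cellSize c′ m
  cellSize-off {m} m≢c₀ =
    trans (cellSize-suc c m)
          (cong (λ b → (if b then 1 else 0) ℕ.+ cellSize c′ m) (dec-false (c₀ Fin.≟ m) (m≢c₀ ∘ sym)))
  without-c₀ : imageWeight x c′ J ≡ R * cellFactor x (J c₀) s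
  without-c₀ = trans (imageWeight≡∏ x c′ J)
                     (∏-split-agreeing c₀ (cellFactors c J) (cellFactors c′ J)
                        (λ m m≢c₀ → cong (cellFactor x (J m)) (cellSize-off m≢c₀)))
  without-c₀-erased : imageWeight x c′ (erase c₀ J) ≡ R * 1ℚ
  without-c₀-erased =
    trans (imageWeight≡∏ x c′ (erase c₀ J))
      (trans (∏-split-agreeing c₀ (cellFactors c J) (cellFactors c′ (erase c₀ J))
                (λ m m≢c₀ → cong₂ (cellFactor x) (sym (erase-there J m≢c₀)) (cellSize-off m≢c₀)))
             (cong (λ b → R * cellFactor x b s) (erase-here c₀ J)))

restrict-cong : ∀ {A : Set} k {J J′ : Fin k → Bool} {D D′ : Fin k → A} →
                (∀ i → J i ≡ J′ i) → (∀ i → D i ≡ D′ i) → restrict k J D ≡ restrict k J′ D′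
restrict-cong zero    J≗J′ D≗D′ = refl
restrict-cong (suc k) {J} {J′} J≗J′ D≗D′ with J zero | J′ zero | J≗J′ zero
... | true  | .true  | refl = cong₂ _∷_ (D≗D′ zero) (restrict-cong k (J≗J′ ∘ suc) (D≗D′ ∘ suc))
... | false | .false | refl = restrict-cong k (J≗J′ ∘ suc) (D≗D′ ∘ suc)

length-restrict : ∀ {A : Set} k (J : Fin k → Bool) (D : Fin k → A) → length (restrict k J D) ≡ card k J
length-restrict zero    J D = refl
length-restrict (suc k) J D with J zero
... | true  = cong suc (length-restrict k (J ∘ suc) (D ∘ suc))
... | false = length-restrict k (J ∘ suc) (D ∘ suc)

∈-restrict⁻ : ∀ {A : Set} k (J : Fin k → Bool) (D : Fin k → A) {x} →
              x ∈ restrict k J D → ∃ λ i → J i ≡ true × D i ≡ x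
∈-restrict⁻ (suc k) J D x∈ with J zero in J₀
∈-restrict⁻ (suc k) J D (here refl) | true = zero , J₀ , refl
∈-restrict⁻ (suc k) J D (there x∈)  | true with ∈-restrict⁻ k (J ∘ suc) (D ∘ suc) x∈
... | i , Ji , Di = suc i , Ji , Di
∈-restrict⁻ (suc k) J D x∈ | false with ∈-restrict⁻ k (J ∘ suc) (D ∘ suc) x∈
... | i , Ji , Di = suc i , Ji , Di

∈-restrict⁺ : ∀ {A : Set} k (J : Fin k → Bool) (D : Fin k → A) i →
              J i ≡ true → D i ∈ restrict k J D
∈-restrict⁺ (suc k) J D zero    Ji with J zero
∈-restrict⁺ (suc k) J D zero refl | .true = here refl
∈-restrict⁺ (suc k) J D (suc i) Ji with J zero
... | true  = there (∈-restrict⁺ k (J ∘ suc) (D ∘ suc) i Ji)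
... | false = ∈-restrict⁺ k (J ∘ suc) (D ∘ suc) i Ji

image⁻ : ∀ {k M} (c : Fin k → Fin M) Q m → image c Q m ≡ true → ∃ λ i → Q i ≡ true × c i ≡ m
image⁻ {suc k} c Q m cQm with Q zero in Q₀ | c zero Fin.≟ m
... | true  | yes c₀≡m = zero , Q₀ , c₀≡m
... | true  | no  _ with image⁻ (c ∘ suc) (Q ∘ suc) m cQm
...   | i , Qi , ci = suc i , Qi , ci
image⁻ {suc k} c Q m cQm | false | _ with image⁻ (c ∘ suc) (Q ∘ suc) m cQm
...   | i , Qi , ci = suc i , Qi , ci

image⁺ : ∀ {k M} (c : Fin k → Fin M) Q i → Q i ≡ true → image c Q (c i) ≡ true
image⁺ c Q zero Qi rewrite Qi | dec-true (c zero Fin.≟ c zero) refl = refl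
image⁺ c Q (suc i) Qi rewrite image⁺ (c ∘ suc) (Q ∘ suc) i Qi = 𝔹P.∨-zeroʳ _

restrict-∘⊆restrict-image : ∀ {k M} {A : Set} (c : Fin k → Fin M) (e : Fin M → A) Q →
                            restrict k Q (e ∘ c) ⊆ restrict M (image c Q) e
restrict-∘⊆restrict-image {k} {M} c e Q x∈ with ∈-restrict⁻ k Q (e ∘ c) x∈
... | i , Qi , refl = ∈-restrict⁺ M (image c Q) e (c i) (image⁺ c Q i Qi)

restrict-image⊆restrict-∘ : ∀ {k M} {A : Set} (c : Fin k → Fin M) (e : Fin M → A) Q →
                            restrict M (image c Q) e ⊆ restrict k Q (e ∘ c)
restrict-image⊆restrict-∘ {k} {M} c e Q x∈ with ∈-restrict⁻ M (image c Q) e x∈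
... | m , cQm , refl with image⁻ c Q m cQm
...   | i , Qi , refl = ∈-restrict⁺ k Q (e ∘ c) i Qi

-- As in 𝔖, the index m stands for the prime p = m + 2, and eulerFactor m = p / (p - 1).
isPrimeDivisorIndex? : ∀ q m → Dec (Prime (suc (suc m)) × suc (suc m) ∣ q)
isPrimeDivisorIndex? q m = prime? (suc (suc m)) ×-dec (suc (suc m) ∣? q)

primeDivisorIndices : ℕ → List ℕ
primeDivisorIndices q = filter (isPrimeDivisorIndex? q) (upTo q)

eulerFactor : ℕ → ℚ
eulerFactor m = ℤ.+ suc (suc m) / suc m

eulerProduct : ℕ → ℚ
eulerProduct q = foldr _*_ 1ℚ (map eulerFactor (primeDivisorIndices q))

residueFactor : List ℕ → ℕ → ℚ
residueFactor D m = 1ℚ - (ℤ.+ ν (suc (suc m)) D / suc (suc m))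

residueProduct : List ℕ → ℕ → ℚ
residueProduct D q = foldr _*_ 1ℚ (map (residueFactor D) (primeDivisorIndices q))

foldr-*-^ : ∀ (xs : List ℕ) (a : ℕ → ℚ) n →
            foldr _*_ 1ℚ (map (λ m → a m ^ n) xs) ≡ foldr _*_ 1ℚ (map a xs) ^ n
foldr-*-^ xs a zero    = ones xs
  where
  ones : ∀ (xs : List ℕ) → foldr _*_ 1ℚ (map (λ _ → 1ℚ) xs) ≡ 1ℚ
  ones []       = refl
  ones (x ∷ xs) = trans (ℚP.*-identityˡ _) (ones xs)
foldr-*-^ xs a (suc n) =
  trans (Prodℚ.foldr-distrib xs a (λ m → a m ^ n))
        (cong (foldr _*_ 1ℚ (map a xs) *_) (foldr-*-^ xs a n))

𝔖-factorisation : ∀ D q → 𝔖 D q ≡ eulerProduct q ^ length D * residueProduct D q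
𝔖-factorisation D q =
  trans (Prodℚ.foldr-distrib (primeDivisorIndices q) (λ m → eulerFactor m ^ length D) (residueFactor D))
        (cong (_* residueProduct D q) (foldr-*-^ (primeDivisorIndices q) eulerFactor (length D)))

ν-cong : ∀ p .{{_ : NonZero p}} {xs ys : List ℕ} → xs ⊆ ys → ys ⊆ xs → ν p xs ≡ ν p ys
ν-cong p {xs} {ys} xs⊆ys ys⊆xs =
  cong length (filter-≐ (occupied xs) (occupied ys) (Any-resp-⊆ xs⊆ys , Any-resp-⊆ ys⊆xs) (upTo p))
  where
  occupied = λ (zs : List ℕ) r → any? (λ d → d ℕ.% p ℕ.≟ r) zs

residueProduct-cong : ∀ {xs ys : List ℕ} q → xs ⊆ ys → ys ⊆ xs →
                      residueProduct xs q ≡ residueProduct ys q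
residueProduct-cong q xs⊆ys ys⊆xs =
  Prodℚ.foldr-cong (primeDivisorIndices q)
    (λ m → cong (λ n → 1ℚ - (ℤ.+ n / suc (suc m))) (ν-cong (suc (suc m)) xs⊆ys ys⊆xs))

fromℕ : ℕ → ℚ
fromℕ n = ℤ.+ n / 1

private
  toℚᵘ-fromℕ : ∀ n → toℚᵘ (fromℕ n) ℚᵘ.≃ ℚᵘ.mkℚᵘ (ℤ.+ n) 0
  toℚᵘ-fromℕ n = toℚᵘ-fromℚᵘ (ℚᵘ.mkℚᵘ (ℤ.+ n) 0)

fromℕ-+ : ∀ a b → fromℕ (a ℕ.+ b) ≡ fromℕ a + fromℕ b
fromℕ-+ a b = toℚᵘ-injective
  (ℚᵘP.≃-trans (toℚᵘ-fromℕ (a ℕ.+ b))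
    (ℚᵘP.≃-trans (ℚᵘ.*≡* numerators)
      (ℚᵘP.≃-sym (ℚᵘP.≃-trans (toℚᵘ-homo-+ (fromℕ a) (fromℕ b))
                              (ℚᵘP.+-cong (toℚᵘ-fromℕ a) (toℚᵘ-fromℕ b))))))
  where
  numerators : ℤ.+ (a ℕ.+ b) ℤ.* ℤ.+ 1 ≡ (ℤ.+ a ℤ.* ℤ.+ 1 ℤ.+ ℤ.+ b ℤ.* ℤ.+ 1) ℤ.* ℤ.+ 1
  numerators = cong (ℤ._* ℤ.+ 1)
    (trans (ℤP.pos-+ a b) (sym (cong₂ ℤ._+_ (ℤP.*-identityʳ (ℤ.+ a)) (ℤP.*-identityʳ (ℤ.+ b)))))

fromℕ-* : ∀ a b → fromℕ (a ℕ.* b) ≡ fromℕ a * fromℕ b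
fromℕ-* a b = toℚᵘ-injective
  (ℚᵘP.≃-trans (toℚᵘ-fromℕ (a ℕ.* b))
    (ℚᵘP.≃-trans (ℚᵘ.*≡* (cong (ℤ._* ℤ.+ 1) (ℤP.pos-* a b)))
      (ℚᵘP.≃-sym (ℚᵘP.≃-trans (toℚᵘ-homo-* (fromℕ a) (fromℕ b))
                              (ℚᵘP.*-cong (toℚᵘ-fromℕ a) (toℚᵘ-fromℕ b))))))

/-*-cancel : ∀ a d → (ℤ.+ a / suc d) * fromℕ (suc d) ≡ fromℕ a
/-*-cancel a d = toℚᵘ-injective
  (ℚᵘP.≃-trans (toℚᵘ-homo-* (ℤ.+ a / suc d) (fromℕ (suc d)))
    (ℚᵘP.≃-trans (ℚᵘP.*-cong (toℚᵘ-fromℚᵘ (ℚᵘ.mkℚᵘ (ℤ.+ a) d)) (toℚᵘ-fromℕ (suc d)))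
      (ℚᵘP.≃-trans (ℚᵘ.*≡* cross) (ℚᵘP.≃-sym (toℚᵘ-fromℕ a)))))
  where
  cross : (ℤ.+ a ℤ.* ℤ.+ suc d) ℤ.* ℤ.+ 1 ≡ ℤ.+ a ℤ.* ℤ.+ suc (d ℕ.* 1)
  cross = trans (ℤP.*-identityʳ _) (cong (λ n → ℤ.+ a ℤ.* ℤ.+ suc n) (sym (ℕP.*-identityʳ d)))

*-fromℕ-cancelʳ : ∀ n {x y} → x * fromℕ (suc n) ≡ y * fromℕ (suc n) → x ≡ y
*-fromℕ-cancelʳ n {x} {y} eq = trans (sym (undo x)) (trans (cong (_* inverse) eq) (undo y))
  where
  inverse = ℤ.+ 1 / suc n
  undo : ∀ z → z * fromℕ (suc n) * inverse ≡ z
  undo z = trans (ℚP.*-assoc z _ inverse)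
                 (trans (cong (z *_) (trans (ℚP.*-comm (fromℕ (suc n)) inverse) (/-*-cancel 1 n)))
                        (ℚP.*-identityʳ z))

sign-^ : ∀ z n → sign n * z ^ n ≡ (- z) ^ n
sign-^ z zero    = refl
sign-^ z (suc n) = trans (rearrange (sign n) z (z ^ n)) (cong (- z *_) (sign-^ z n))
  where
  open +-*-Solver
  rearrange : ∀ s z t → (- s) * (z * t) ≡ (- z) * (s * t)
  rearrange = solve 3 (λ s z t → (:- s) :* (z :* t) := (:- z) :* (s :* t)) refl

big-*ˡ : ∀ n a (f : ℕ → ℚ) → a * Sumℚ.big n f ≡ Sumℚ.big n (λ i → a * f i)
big-*ˡ zero    a f = ℚP.*-zeroʳ a
big-*ˡ (suc n) a f = trans (ℚP.*-distribˡ-+ a (f 0) _) (cong (a * f 0 +_) (big-*ˡ n a (f ∘ suc)))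

binomialSum : ℚ → ℕ → ℚ
binomialSum w ℓ = Sumℚ.big (suc ℓ) (λ j → fromℕ (ℓ C j) * w ^ j)

-- binomialSum w ℓ is definitionally 1ℚ * 1ℚ + upperTerms w ℓ ℓ.
upperTerms : ℚ → ℕ → ℕ → ℚ
upperTerms w ℓ n = Sumℚ.big n (λ i → fromℕ (ℓ C suc i) * w ^ suc i)

upperTerms-suc : ∀ w ℓ → upperTerms w ℓ (suc ℓ) ≡ upperTerms w ℓ ℓ
upperTerms-suc w ℓ =
  trans (Sumℚ.big-snoc ℓ _)
    (trans (cong (λ n → upperTerms w ℓ ℓ + fromℕ n * w ^ suc ℓ) (k>n⇒nCk≡0 (ℕP.n<1+n ℓ)))
      (trans (cong (upperTerms w ℓ ℓ +_) (ℚP.*-zeroˡ (w ^ suc ℓ))) (ℚP.+-identityʳ _)))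

binomial-theorem : ∀ w ℓ → binomialSum w ℓ ≡ (1ℚ + w) ^ ℓ
binomial-theorem w zero    = refl
binomial-theorem w (suc ℓ) = begin
  1ℚ * 1ℚ + upperTerms w (suc ℓ) (suc ℓ)
    ≡⟨ cong (1ℚ * 1ℚ +_) (Sumℚ.big-cong (suc ℓ) pascal) ⟩
  1ℚ * 1ℚ + Sumℚ.big (suc ℓ) (λ i → w * term i + upper i)
    ≡⟨ cong (1ℚ * 1ℚ +_) (trans (Sumℚ.big-distrib (suc ℓ) (λ i → w * term i) upper)
                                 (cong (_+ upperTerms w ℓ (suc ℓ)) (sym (big-*ˡ (suc ℓ) w term)))) ⟩
  1ℚ * 1ℚ + (w * binomialSum w ℓ + upperTerms w ℓ (suc ℓ))
    ≡⟨ cong (λ t → 1ℚ * 1ℚ + (w * binomialSum w ℓ + t)) (upperTerms-suc w ℓ) ⟩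
  1ℚ * 1ℚ + (w * binomialSum w ℓ + upperTerms w ℓ ℓ)
    ≡⟨ swap (1ℚ * 1ℚ) (w * binomialSum w ℓ) (upperTerms w ℓ ℓ) ⟩
  w * binomialSum w ℓ + binomialSum w ℓ
    ≡⟨ factor w (binomialSum w ℓ) ⟩
  (1ℚ + w) * binomialSum w ℓ
    ≡⟨ cong ((1ℚ + w) *_) (binomial-theorem w ℓ) ⟩
  (1ℚ + w) ^ suc ℓ ∎
  where
  open ≡-Reasoning
  open +-*-Solver
  term = λ j → fromℕ (ℓ C j) * w ^ j
  upper = λ i → fromℕ (ℓ C suc i) * w ^ suc i
  pascal : ∀ i → fromℕ (suc ℓ C suc i) * w ^ suc i ≡ w * term i + upper i
  pascal i = trans (cong (λ n → fromℕ n * w ^ suc i) (sym (nCk+nC[k+1]≡[n+1]C[k+1] ℓ i)))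
               (trans (cong (_* w ^ suc i) (fromℕ-+ (ℓ C i) (ℓ C suc i)))
                      (split (fromℕ (ℓ C i)) (fromℕ (ℓ C suc i)) w (w ^ i)))
    where
    split : ∀ a b w t → (a + b) * (w * t) ≡ w * (a * t) + b * (w * t)
    split = solve 4 (λ a b w t → (a :+ b) :* (w :* t) := w :* (a :* t) :+ b :* (w :* t)) refl
  swap : ∀ a b c → a + (b + c) ≡ b + (a + c)
  swap = solve 3 (λ a b c → a :+ (b :+ c) := b :+ (a :+ c)) refl
  factor : ∀ w b → w * b + b ≡ (1ℚ + w) * b
  factor = solve 2 (λ w b → w :* b :+ b := (con 1ℚ :+ w) :* b) refl

z*P≡[1-z]^ℓ-1 : ∀ ℓ z → z * P ℓ z ≡ (1ℚ + - z) ^ ℓ - 1ℚ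
z*P≡[1-z]^ℓ-1 ℓ z = begin
  z * P ℓ z
    ≡⟨ cong (z *_) (Sumℚ.foldr-upTo ℓ term) ⟩
  z * Sumℚ.big ℓ term
    ≡⟨ big-*ˡ ℓ z term ⟩
  Sumℚ.big ℓ (λ i → z * term i)
    ≡⟨ Sumℚ.big-cong ℓ signed ⟩
  upperTerms (- z) ℓ ℓ
    ≡⟨ add-sub (upperTerms (- z) ℓ ℓ) ⟩
  binomialSum (- z) ℓ - 1ℚ
    ≡⟨ cong (_- 1ℚ) (binomial-theorem (- z) ℓ) ⟩
  (1ℚ + - z) ^ ℓ - 1ℚ ∎
  where
  open ≡-Reasoning
  open +-*-Solver
  term = λ i → fromℕ (ℓ C suc i) * sign (suc i) * z ^ i
  signed : ∀ i → z * term i ≡ fromℕ (ℓ C suc i) * (- z) ^ suc i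
  signed i = trans (rearrange (fromℕ (ℓ C suc i)) (sign (suc i)) z (z ^ i))
                   (cong (fromℕ (ℓ C suc i) *_) (sign-^ z (suc i)))
    where
    rearrange : ∀ a s z t → z * (a * s * t) ≡ a * (s * (z * t))
    rearrange = solve 4 (λ a s z t → z :* (a :* s :* t) := a :* (s :* (z :* t))) refl
  add-sub : ∀ y → y ≡ 1ℚ * 1ℚ + y - 1ℚ
  add-sub = solve 1 (λ y → y := con 1ℚ :* con 1ℚ :+ y :- con 1ℚ) refl

prime⇒≡2+ : ∀ {p} → Prime p → ∃ λ s → p ≡ suc (suc s)
prime⇒≡2+ {p} p-prime with ℕ.nonTrivial⇒n>1 p {{prime⇒nonTrivial p-prime}}
prime⇒≡2+ {suc (suc s)} _ | _ = s , refl

prime≢1 : ∀ {p} → Prime p → p ≢ 1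
prime≢1 p-prime p≡1 with prime⇒≡2+ p-prime
... | s , refl with p≡1
... | ()

prime∣*⇒≡∨∣ : ∀ {x p} r → Prime x → Prime p → x ∣ p ℕ.* r → x ≡ p ⊎ x ∣ r
prime∣*⇒≡∨∣ {p = p} r x-prime p-prime x∣pr with euclidsLemma p r x-prime x∣pr
... | inj₂ x∣r = inj₂ x∣r
... | inj₁ x∣p with prime⇒irreducible p-prime x∣p
...   | inj₁ refl = ⊥-elim (prime≢1 x-prime refl)
...   | inj₂ x≡p  = inj₁ x≡p

coprime-+⁻ : ∀ {x r} → Coprime (r ℕ.+ x) r → Coprime x r
coprime-+⁻ coprime (i∣x , i∣r) = coprime (∣m∣n⇒∣m+n i∣r i∣x , i∣r)

coprime-* : ∀ {a p r} → Coprime a p → Coprime a r → Coprime a (p ℕ.* r)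
coprime-* {a} cp cr {i} (i∣a , i∣pr) = cr (i∣a , coprime-divisor i⊥p i∣pr)
  where
  i⊥p : Coprime i _
  i⊥p (j∣i , j∣p) = cp (∣-trans j∣i i∣a , j∣p)

coprime-*⁻ˡ : ∀ {a p} r → Coprime a (p ℕ.* r) → Coprime a p
coprime-*⁻ˡ r coprime (i∣a , i∣p) = coprime (i∣a , ∣m⇒∣m*n r i∣p)

coprime-*⁻ʳ : ∀ {a} p {r} → Coprime a (p ℕ.* r) → Coprime a r
coprime-*⁻ʳ p coprime (i∣a , i∣r) = coprime (i∣a , ∣n⇒∣m*n p i∣r)

coprime-∣ : ∀ {a p r} → p ∣ r → Coprime a r → Coprime a p
coprime-∣ p∣r coprime (i∣a , i∣p) = coprime (i∣a , ∣-trans i∣p p∣r)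

coprime-prime⇒∤ : ∀ {a p} → Prime p → Coprime a p → ¬ p ∣ a
coprime-prime⇒∤ p-prime coprime p∣a = prime≢1 p-prime (coprime (p∣a , ∣-refl))

∤⇒coprime-prime : ∀ {a p} → Prime p → ¬ p ∣ a → Coprime a p
∤⇒coprime-prime p-prime p∤a {i} (i∣a , i∣p) with prime⇒irreducible p-prime i∣p
... | inj₁ i≡1  = i≡1
... | inj₂ refl = ⊥-elim (p∤a i∣a)

module Sumℕ = BigOperator ℕP.+-0-isCommutativeMonoid
module Prodℕ = BigOperator ℕP.*-1-isCommutativeMonoid

indicator : Bool → ℕ
indicator b = if b then 1 else 0

length-filter : ∀ {A : Set} {ℓ} {P : Pred A ℓ} (P? : Decidable P) (xs : List A) →
                length (filter P? xs) ≡ foldr ℕ._+_ 0 (map (λ x → indicator (does (P? x))) xs)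
length-filter P? []       = refl
length-filter P? (x ∷ xs) with does (P? x)
... | true  = cong suc (length-filter P? xs)
... | false = length-filter P? xs

isCoprime : ℕ → ℕ → ℕ
isCoprime a r = indicator (does (coprime? a r))

isCoprime-cong : ∀ a b {r s} → (Coprime a r → Coprime b s) → (Coprime b s → Coprime a r) →
                 isCoprime a r ≡ isCoprime b s
isCoprime-cong a b {r} {s} to from = cong indicator (does-⇔ (mk⇔ to from) (coprime? a r) (coprime? b s))

coprimeCount : ℕ → ℕ → ℕ
coprimeCount N r = Sumℕ.big N (λ i → isCoprime (suc i) r)

φ≡coprimeCount : ∀ r → φ r ≡ coprimeCount r r
φ≡coprimeCount r =
  trans (length-filter (λ a → coprime? a r) (map suc (upTo r)))
    (trans (cong (foldr ℕ._+_ 0) (sym (map-∘ (upTo r))))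
           (Sumℕ.foldr-upTo r (λ i → isCoprime (suc i) r)))

coprimeCount-periodic : ∀ n r → coprimeCount (n ℕ.* r) r ≡ n ℕ.* coprimeCount r r
coprimeCount-periodic zero    r = refl
coprimeCount-periodic (suc n) r =
  trans (Sumℕ.big-+ r (n ℕ.* r) _)
    (cong (coprimeCount r r ℕ.+_) (trans (Sumℕ.big-cong (n ℕ.* r) shift) (coprimeCount-periodic n r)))
  where
  shift : ∀ i → isCoprime (suc (r ℕ.+ i)) r ≡ isCoprime (suc i) r
  shift i = trans (cong (λ a → isCoprime a r) (sym (ℕP.+-suc r i)))
                  (isCoprime-cong (r ℕ.+ suc i) (suc i) coprime-+⁻ coprime-+)

φ-*-∣ : ∀ {p r} → p ∣ r → φ (p ℕ.* r) ≡ p ℕ.* φ r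
φ-*-∣ {p} {r} p∣r = begin
  φ (p ℕ.* r)                 ≡⟨ φ≡coprimeCount (p ℕ.* r) ⟩
  coprimeCount (p ℕ.* r) (p ℕ.* r) ≡⟨ Sumℕ.big-cong (p ℕ.* r) same-coprimality ⟩
  coprimeCount (p ℕ.* r) r    ≡⟨ coprimeCount-periodic p r ⟩
  p ℕ.* coprimeCount r r      ≡⟨ cong (p ℕ.*_) (sym (φ≡coprimeCount r)) ⟩
  p ℕ.* φ r                   ∎
  where
  open ≡-Reasoning
  same-coprimality : ∀ i → isCoprime (suc i) (p ℕ.* r) ≡ isCoprime (suc i) r
  same-coprimality i = isCoprime-cong (suc i) (suc i) (coprime-*⁻ʳ p) (λ c → coprime-* (coprime-∣ p∣r c) c)

sum-multiples : ∀ {p} → Prime p → ∀ n (h : ℕ → ℕ) →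
                Sumℕ.big (n ℕ.* p) (λ i → if does (p ∣? suc i) then h (suc i) else 0)
                  ≡ Sumℕ.big n (λ j → h (p ℕ.* suc j))
sum-multiples p-prime zero    h = refl
sum-multiples {p} p-prime (suc n) h with prime⇒≡2+ p-prime
... | s , refl =
  trans (Sumℕ.big-+ p (n ℕ.* p) F)
    (cong₂ ℕ._+_ first-block
      (trans (Sumℕ.big-cong (n ℕ.* p) shift)
        (trans (sum-multiples p-prime n (λ x → h (p ℕ.+ x)))
               (Sumℕ.big-cong n (λ j → cong h (sym (ℕP.*-suc p (suc j))))))))
  where
  F = λ i → if does (p ∣? suc i) then h (suc i) else 0
  first-block : Sumℕ.big p F ≡ h (p ℕ.* 1)
  first-block = trans (Sumℕ.big-snoc (suc s) F)
                  (trans (cong₂ ℕ._+_ below-p at-p) (cong h (sym (ℕP.*-identityʳ p))))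
    where
    below-p : Sumℕ.big (suc s) F ≡ 0
    below-p = trans (Sumℕ.big-cong< (suc s) (λ i i<1+s →
                       cong (λ b → if b then h (suc i) else 0) (dec-false (p ∣? suc i) (>⇒∤ (s≤s i<1+s)))))
                    (Sumℕ.big-identity (suc s))
    at-p : F (suc s) ≡ h p
    at-p = cong (λ b → if b then h p else 0) (dec-true (p ∣? p) ∣-refl)
  shift : ∀ i → F (p ℕ.+ i) ≡ (if does (p ∣? suc i) then h (p ℕ.+ suc i) else 0)
  shift i = cong₂ (λ b x → if b then h x else 0)
    (does-⇔ (mk⇔ (λ p∣ → ∣m+n∣m⇒∣n (subst (p ∣_) (sym (ℕP.+-suc p i)) p∣) ∣-refl)
                 (λ p∣ → subst (p ∣_) (ℕP.+-suc p i) (∣m∣n⇒∣m+n ∣-refl p∣)))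
            (p ∣? suc (p ℕ.+ i)) (p ∣? suc i))
    (sym (ℕP.+-suc p i))

-- Of the numbers 1, …, p r coprime to r, the multiples of p are the p j with j ≤ r coprime to r,
-- and the others are exactly the numbers coprime to p r.
φ-*-∤ : ∀ {p r} → Prime p → ¬ p ∣ r → φ r ℕ.+ φ (p ℕ.* r) ≡ p ℕ.* φ r
φ-*-∤ {p} {r} p-prime p∤r = sym (begin
  p ℕ.* φ r
    ≡⟨ cong (p ℕ.*_) (φ≡coprimeCount r) ⟩
  p ℕ.* coprimeCount r r
    ≡⟨ sym (coprimeCount-periodic p r) ⟩
  coprimeCount (p ℕ.* r) r
    ≡⟨ Sumℕ.big-cong (p ℕ.* r) split ⟩
  Sumℕ.big (p ℕ.* r) (λ i → multiple i ℕ.+ isCoprime (suc i) (p ℕ.* r))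
    ≡⟨ Sumℕ.big-distrib (p ℕ.* r) _ _ ⟩
  Sumℕ.big (p ℕ.* r) multiple ℕ.+ coprimeCount (p ℕ.* r) (p ℕ.* r)
    ≡⟨ cong₂ ℕ._+_ multiples (sym (φ≡coprimeCount (p ℕ.* r))) ⟩
  φ r ℕ.+ φ (p ℕ.* r) ∎)
  where
  open ≡-Reasoning
  G = λ a → isCoprime a r
  multiple = λ i → if does (p ∣? suc i) then G (suc i) else 0
  split : ∀ i → G (suc i) ≡ multiple i ℕ.+ isCoprime (suc i) (p ℕ.* r)
  split i with p ∣? suc i
  ... | yes p∣ = sym (trans (cong (λ b → G (suc i) ℕ.+ indicator b)
                                   (dec-false (coprime? (suc i) (p ℕ.* r))
                                              (λ c → coprime-prime⇒∤ p-prime (coprime-*⁻ˡ r c) p∣)))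
                            (ℕP.+-identityʳ _))
  ... | no  p∤ = isCoprime-cong (suc i) (suc i) (coprime-* (∤⇒coprime-prime p-prime p∤)) (coprime-*⁻ʳ p)
  multiples : Sumℕ.big (p ℕ.* r) multiple ≡ φ r
  multiples = begin
    Sumℕ.big (p ℕ.* r) multiple
      ≡⟨ cong (λ N → Sumℕ.big N multiple) (ℕP.*-comm p r) ⟩
    Sumℕ.big (r ℕ.* p) multiple
      ≡⟨ sum-multiples p-prime r G ⟩
    Sumℕ.big r (λ j → G (p ℕ.* suc j))
      ≡⟨ Sumℕ.big-cong r (λ j → isCoprime-cong (p ℕ.* suc j) (suc j) unscale scale) ⟩
    coprimeCount r r
      ≡⟨ sym (φ≡coprimeCount r) ⟩
    φ r ∎
    where
    p⊥r : Coprime p r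
    p⊥r = Coprimality.sym (∤⇒coprime-prime p-prime p∤r)
    unscale : ∀ {b} → Coprime (p ℕ.* b) r → Coprime b r
    unscale c = Coprimality.sym (coprime-*⁻ʳ p (Coprimality.sym c))
    scale : ∀ {b} → Coprime b r → Coprime (p ℕ.* b) r
    scale c = Coprimality.sym (coprime-* (Coprimality.sym p⊥r) (Coprimality.sym c))

onPrimeDivisors : ℕ → (ℕ → ℕ) → ℕ → ℕ
onPrimeDivisors q a m = if does (isPrimeDivisorIndex? q m) then a m else 1

primeDivisorProduct : ℕ → (ℕ → ℕ) → ℕ
primeDivisorProduct q a = Prodℕ.big q (onPrimeDivisors q a)

foldr-primeDivisorIndices : ∀ q a → foldr ℕ._*_ 1 (map a (primeDivisorIndices q)) ≡ primeDivisorProduct q a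
foldr-primeDivisorIndices q a =
  trans (Prodℕ.foldr-filter (isPrimeDivisorIndex? q) (upTo q) a) (Prodℕ.foldr-upTo q (onPrimeDivisors q a))

primeDivisorProduct-extend : ∀ {q N} a → 1 ℕ.≤ q → q ℕ.≤ N →
                             Prodℕ.big N (onPrimeDivisors q a) ≡ primeDivisorProduct q a
primeDivisorProduct-extend {q@(suc _)} {N} a _ q≤N =
  trans (cong (λ n → Prodℕ.big n (onPrimeDivisors q a)) (sym (ℕP.m+[n∸m]≡n q≤N)))
    (trans (Prodℕ.big-+ q (N ℕ.∸ q) (onPrimeDivisors q a))
      (trans (cong (primeDivisorProduct q a ℕ.*_)
                   (trans (Prodℕ.big-cong (N ℕ.∸ q) beyond) (Prodℕ.big-identity (N ℕ.∸ q))))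
             (ℕP.*-identityʳ _)))
  where
  beyond : ∀ i → onPrimeDivisors q a (q ℕ.+ i) ≡ 1
  beyond i = cong (λ b → if b then a (q ℕ.+ i) else 1)
               (dec-false (isPrimeDivisorIndex? q (q ℕ.+ i))
                  (λ (_ , p∣q) → >⇒∤ (s≤s (ℕP.≤-trans (ℕP.m≤m+n q i) (ℕP.n≤1+n _))) p∣q))

primeDivisorProduct-*-∣ : ∀ {p r} a → Prime p → p ∣ r → 1 ℕ.≤ r →
                          primeDivisorProduct (p ℕ.* r) a ≡ primeDivisorProduct r a
primeDivisorProduct-*-∣ {p} {r} a p-prime p∣r r≥1 =
  trans (Prodℕ.big-cong (p ℕ.* r) (λ m → cong (λ b → if b then a m else 1) (same-divisors m)))
        (primeDivisorProduct-extend a r≥1 (ℕP.m≤n*m r p {{prime⇒nonZero p-prime}}))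
  where
  same-divisors : ∀ m → does (isPrimeDivisorIndex? (p ℕ.* r) m) ≡ does (isPrimeDivisorIndex? r m)
  same-divisors m = does-⇔ (mk⇔ to (λ (x-prime , x∣r) → x-prime , ∣n⇒∣m*n p x∣r))
                           (isPrimeDivisorIndex? (p ℕ.* r) m) (isPrimeDivisorIndex? r m)
    where
    to : Prime (suc (suc m)) × suc (suc m) ∣ p ℕ.* r → Prime (suc (suc m)) × suc (suc m) ∣ r
    to (x-prime , x∣pr) with prime∣*⇒≡∨∣ r x-prime p-prime x∣pr
    ... | inj₁ refl = x-prime , p∣r
    ... | inj₂ x∣r  = x-prime , x∣r

primeDivisorProduct-*-∤ : ∀ {s r} a → Prime (suc (suc s)) → ¬ suc (suc s) ∣ r → 1 ℕ.≤ r →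
                          primeDivisorProduct (suc (suc s) ℕ.* r) a ≡ primeDivisorProduct r a ℕ.* a s
primeDivisorProduct-*-∤ {s} {r} a p-prime p∤r r≥1 = begin
  Prodℕ.big pr (onPrimeDivisors pr a)
    ≡⟨ sym (ℕP.*-identityʳ _) ⟩
  Prodℕ.big pr (onPrimeDivisors pr a) ℕ.* 1
    ≡⟨ cong (λ b → Prodℕ.big pr (onPrimeDivisors pr a) ℕ.* (if b then a s else 1))
            (sym (dec-false (isPrimeDivisorIndex? r s) (p∤r ∘ proj₂))) ⟩
  Prodℕ.big pr (onPrimeDivisors pr a) ℕ.* onPrimeDivisors r a s
    ≡⟨ Prodℕ.big-update pr s (onPrimeDivisors pr a) (onPrimeDivisors r a) s<pr
         (λ m m≢s → cong (λ b → if b then a m else 1) (other-divisors m m≢s)) ⟩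
  Prodℕ.big pr (onPrimeDivisors r a) ℕ.* onPrimeDivisors pr a s
    ≡⟨ cong₂ ℕ._*_ (primeDivisorProduct-extend a r≥1 (ℕP.m≤n*m r p))
                   (cong (λ b → if b then a s else 1)
                         (dec-true (isPrimeDivisorIndex? pr s) (p-prime , ∣m⇒∣m*n r ∣-refl))) ⟩
  primeDivisorProduct r a ℕ.* a s ∎
  where
  open ≡-Reasoning
  p = suc (suc s)
  pr = p ℕ.* r
  s<pr : s ℕ.< pr
  s<pr = ℕP.≤-trans (ℕP.n≤1+n (suc s)) (ℕP.m≤m*n p r {{ℕ.>-nonZero r≥1}})
  other-divisors : ∀ m → m ≢ s → does (isPrimeDivisorIndex? pr m) ≡ does (isPrimeDivisorIndex? r m)
  other-divisors m m≢s = does-⇔ (mk⇔ to (λ (x-prime , x∣r) → x-prime , ∣n⇒∣m*n p x∣r))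
                                (isPrimeDivisorIndex? pr m) (isPrimeDivisorIndex? r m)
    where
    to : Prime (suc (suc m)) × suc (suc m) ∣ pr → Prime (suc (suc m)) × suc (suc m) ∣ r
    to (x-prime , x∣pr) with prime∣*⇒≡∨∣ r x-prime p-prime x∣pr
    ... | inj₁ x≡p = ⊥-elim (m≢s (ℕP.suc-injective (ℕP.suc-injective x≡p)))
    ... | inj₂ x∣r = x-prime , x∣r

EulerIdentity : ℕ → Set
EulerIdentity r = φ r ℕ.* primeDivisorProduct r (λ m → suc (suc m)) ≡ r ℕ.* primeDivisorProduct r suc

eulerIdentity-product : ∀ ps → All Prime ps → EulerIdentity (product ps)
eulerIdentity-product []       []                      = refl
eulerIdentity-product (p ∷ ps) (p-prime ∷ ps-prime) with prime⇒≡2+ p-prime | p ∣? product ps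
... | s , refl | yes p∣r = begin
  φ (p ℕ.* r) ℕ.* N (p ℕ.* r)
    ≡⟨ cong₂ ℕ._*_ (φ-*-∣ p∣r) (primeDivisorProduct-*-∣ (λ m → suc (suc m)) p-prime p∣r r≥1) ⟩
  p ℕ.* φ r ℕ.* N r
    ≡⟨ ℕP.*-assoc p (φ r) (N r) ⟩
  p ℕ.* (φ r ℕ.* N r)
    ≡⟨ cong (p ℕ.*_) (eulerIdentity-product ps ps-prime) ⟩
  p ℕ.* (r ℕ.* D r)
    ≡⟨ sym (ℕP.*-assoc p r (D r)) ⟩
  p ℕ.* r ℕ.* D r
    ≡⟨ cong (p ℕ.* r ℕ.*_) (sym (primeDivisorProduct-*-∣ suc p-prime p∣r r≥1)) ⟩
  p ℕ.* r ℕ.* D (p ℕ.* r) ∎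
  where
  open ≡-Reasoning
  r = product ps
  r≥1 = productOfPrimes≥1 ps-prime
  N = λ q → primeDivisorProduct q (λ m → suc (suc m))
  D = λ q → primeDivisorProduct q suc
... | s , refl | no p∤r = begin
  φ (p ℕ.* r) ℕ.* N (p ℕ.* r)
    ≡⟨ cong₂ ℕ._*_ φ-pr (primeDivisorProduct-*-∤ (λ m → suc (suc m)) p-prime p∤r r≥1) ⟩
  suc s ℕ.* φ r ℕ.* (N r ℕ.* p)
    ≡⟨ regroup₁ s (φ r) (N r) ⟩
  suc s ℕ.* (φ r ℕ.* N r) ℕ.* p
    ≡⟨ cong (λ z → suc s ℕ.* z ℕ.* p) (eulerIdentity-product ps ps-prime) ⟩
  suc s ℕ.* (r ℕ.* D r) ℕ.* p
    ≡⟨ regroup₂ s r (D r) ⟩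
  p ℕ.* r ℕ.* (D r ℕ.* suc s)
    ≡⟨ cong (p ℕ.* r ℕ.*_) (sym (primeDivisorProduct-*-∤ suc p-prime p∤r r≥1)) ⟩
  p ℕ.* r ℕ.* D (p ℕ.* r) ∎
  where
  open ≡-Reasoning
  open ℕSolver
  r = product ps
  r≥1 = productOfPrimes≥1 ps-prime
  N = λ q → primeDivisorProduct q (λ m → suc (suc m))
  D = λ q → primeDivisorProduct q suc
  φ-pr : φ (p ℕ.* r) ≡ suc s ℕ.* φ r
  φ-pr = ℕP.+-cancelˡ-≡ (φ r) _ _ (φ-*-∤ p-prime p∤r)
  regroup₁ : ∀ s f n → suc s ℕ.* f ℕ.* (n ℕ.* suc (suc s)) ≡ suc s ℕ.* (f ℕ.* n) ℕ.* suc (suc s)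
  regroup₁ = solve 3 (λ s f n → (con 1 :+ s) :* f :* (n :* (con 2 :+ s))
                                := (con 1 :+ s) :* (f :* n) :* (con 2 :+ s)) refl
  regroup₂ : ∀ s r d → suc s ℕ.* (r ℕ.* d) ℕ.* suc (suc s) ≡ suc (suc s) ℕ.* r ℕ.* (d ℕ.* suc s)
  regroup₂ = solve 3 (λ s r d → (con 1 :+ s) :* (r :* d) :* (con 2 :+ s)
                                := (con 2 :+ s) :* r :* (d :* (con 1 :+ s))) refl

eulerIdentity : ∀ q → 1 ℕ.≤ q → EulerIdentity q
eulerIdentity q@(suc _) _ = subst EulerIdentity (sym isFactorisation) (eulerIdentity-product factors factorsPrime)
  where open PrimeFactorisation (factorise q)

eulerProduct-*-fromℕ : ∀ xs → foldr _*_ 1ℚ (map eulerFactor xs) * fromℕ (foldr ℕ._*_ 1 (map suc xs))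
                              ≡ fromℕ (foldr ℕ._*_ 1 (map (λ m → suc (suc m)) xs))
eulerProduct-*-fromℕ []       = ℚP.*-identityˡ _
eulerProduct-*-fromℕ (m ∷ xs) = begin
  eulerFactor m * E * fromℕ (suc m ℕ.* d)
    ≡⟨ cong (eulerFactor m * E *_) (fromℕ-* (suc m) d) ⟩
  eulerFactor m * E * (fromℕ (suc m) * fromℕ d)
    ≡⟨ interchange (eulerFactor m) E (fromℕ (suc m)) (fromℕ d) ⟩
  eulerFactor m * fromℕ (suc m) * (E * fromℕ d)
    ≡⟨ cong₂ _*_ (/-*-cancel (suc (suc m)) m) (eulerProduct-*-fromℕ xs) ⟩
  fromℕ (suc (suc m)) * fromℕ (foldr ℕ._*_ 1 (map (λ m → suc (suc m)) xs))
    ≡⟨ sym (fromℕ-* (suc (suc m)) (foldr ℕ._*_ 1 (map (λ m → suc (suc m)) xs))) ⟩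
  fromℕ (suc (suc m) ℕ.* foldr ℕ._*_ 1 (map (λ m → suc (suc m)) xs)) ∎
  where
  open ≡-Reasoning
  open +-*-Solver
  E = foldr _*_ 1ℚ (map eulerFactor xs)
  d = foldr ℕ._*_ 1 (map suc xs)
  interchange : ∀ a b c d → a * b * (c * d) ≡ a * c * (b * d)
  interchange = solve 4 (λ a b c d → a :* b :* (c :* d) := a :* c :* (b :* d)) refl

product-suc : ∀ (xs : List ℕ) → ∃ λ y → foldr ℕ._*_ 1 (map suc xs) ≡ suc y
product-suc []       = 0 , refl
product-suc (m ∷ xs) with product-suc xs
... | y , eq = _ , cong (suc m ℕ.*_) eq

qOverφ≡eulerProduct : ∀ q → 1 ℕ.≤ q → qOverφ q ≡ eulerProduct q
qOverφ≡eulerProduct q q≥1 with φ q | identity | product-suc (primeDivisorIndices q)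
  where
  identity : φ q ℕ.* foldr ℕ._*_ 1 (map (λ m → suc (suc m)) (primeDivisorIndices q))
             ≡ q ℕ.* foldr ℕ._*_ 1 (map suc (primeDivisorIndices q))
  identity = trans (cong (φ q ℕ.*_) (foldr-primeDivisorIndices q (λ m → suc (suc m))))
               (trans (eulerIdentity q q≥1) (cong (q ℕ.*_) (sym (foldr-primeDivisorIndices q suc))))
qOverφ≡eulerProduct q@(suc _) _ | zero  | identity | y , eq with trans identity (cong (q ℕ.*_) eq)
... | ()
qOverφ≡eulerProduct q@(suc _) _ | suc n | identity | y , eq =
  *-fromℕ-cancelʳ n (*-fromℕ-cancelʳ y (begin
    ℤ.+ q / suc n * fromℕ (suc n) * fromℕ (suc y)
      ≡⟨ cong (_* fromℕ (suc y)) (/-*-cancel q n) ⟩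
    fromℕ q * fromℕ (suc y)
      ≡⟨ sym (fromℕ-* q (suc y)) ⟩
    fromℕ (q ℕ.* suc y)
      ≡⟨ cong fromℕ (sym (trans identity (cong (q ℕ.*_) eq))) ⟩
    fromℕ (suc n ℕ.* numerator)
      ≡⟨ trans (cong fromℕ (ℕP.*-comm (suc n) numerator)) (fromℕ-* numerator (suc n)) ⟩
    fromℕ numerator * fromℕ (suc n)
      ≡⟨ cong (λ z → z * fromℕ (suc n)) (sym (trans (cong (λ z → eulerProduct q * fromℕ z) (sym eq))
                                                     (eulerProduct-*-fromℕ (primeDivisorIndices q)))) ⟩
    eulerProduct q * fromℕ (suc y) * fromℕ (suc n)
      ≡⟨ xy∙z≈xz∙y (eulerProduct q) (fromℕ (suc y)) (fromℕ (suc n)) ⟩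
    eulerProduct q * fromℕ (suc n) * fromℕ (suc y) ∎))
  where
  open ≡-Reasoning
  numerator = foldr ℕ._*_ 1 (map (λ m → suc (suc m)) (primeDivisorIndices q))

prodOver-*-^card : ∀ M (J : Fin M → Bool) (a : Fin M → ℚ) z →
                   prodOver M J a * z ^ card M J ≡ ∏ (λ m → if J m then z * a m else 1ℚ)
prodOver-*-^card zero    J a z = refl
prodOver-*-^card (suc M) J a z with J zero
... | true  = trans (rearrange (a zero) (prodOver M (J ∘ suc) (a ∘ suc)) z (z ^ card M (J ∘ suc)))
                    (cong (z * a zero *_) (prodOver-*-^card M (J ∘ suc) (a ∘ suc) z))
  where
  open +-*-Solver
  rearrange : ∀ a p z t → a * p * (z * t) ≡ z * a * (p * t)
  rearrange = solve 4 (λ a p z t → a :* p :* (z :* t) := z :* a :* (p :* t)) refl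
... | false = trans (prodOver-*-^card M (J ∘ suc) (a ∘ suc) z) (sym (ℚP.*-identityˡ _))

𝔖-restrict : ∀ k Q (D : Fin k → ℕ) q →
             𝔖 (restrict k Q D) q ≡ eulerProduct q ^ card k Q * residueProduct (restrict k Q D) q
𝔖-restrict k Q D q =
  trans (𝔖-factorisation (restrict k Q D) q)
        (cong (λ l → eulerProduct q ^ l * residueProduct (restrict k Q D) q) (length-restrict k Q D))

module FixedTuple {k M} (c : Fin k → Fin M) (q : ℕ) (e : Fin M → ℕ) where

  π : ℚ
  π = eulerProduct q

  residue : (Fin M → Bool) → ℚ
  residue J = residueProduct (restrict M J e) q

  residue-cong : ∀ {J J′} → (∀ m → J m ≡ J′ m) → residue J ≡ residue J′
  residue-cong J≗J′ = cong (λ L → residueProduct L q) (restrict-cong M J≗J′ (λ _ → refl))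

  cellProduct : (Fin M → Bool) → ℚ
  cellProduct J = ∏ (λ m → cellFactor (- π) (J m) (cellSize c m))

  signedSum : ℚ
  signedSum = sumSubsets k (λ Q → sign (card k Q) * 𝔖 (restrict k Q (e ∘ c)) q)

  cellSum : ℚ
  cellSum = sumSubsets M (λ J → prodOver M J (λ m → P (cellSize c m) (qOverφ q)) * 𝔖 (restrict M J e) q)

  signedTerm : ∀ Q → sign (card k Q) * 𝔖 (restrict k Q (e ∘ c)) q
                     ≡ sumSubsets M (λ J → ⟦ J ≗ image c Q ⟧ * (- π) ^ card k Q * residue J)
  signedTerm Q = begin
    sign n * 𝔖 (restrict k Q (e ∘ c)) q
      ≡⟨ cong (sign n *_) (𝔖-restrict k Q (e ∘ c) q) ⟩
    sign n * (π ^ n * residueProduct (restrict k Q (e ∘ c)) q)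
      ≡⟨ sym (ℚP.*-assoc (sign n) (π ^ n) _) ⟩
    sign n * π ^ n * residueProduct (restrict k Q (e ∘ c)) q
      ≡⟨ cong₂ _*_ (sign-^ π n) (residueProduct-cong q (restrict-∘⊆restrict-image c e Q)
                                                       (restrict-image⊆restrict-∘ c e Q)) ⟩
    (- π) ^ n * residue (image c Q)
      ≡⟨ cong ((- π) ^ n *_)
              (sym (sumAll-⟦≗⟧ M bools (image c Q) residue bools-distinct ∈bools residue-cong)) ⟩
    (- π) ^ n * sumSubsets M (λ J → ⟦ J ≗ image c Q ⟧ * residue J)
      ≡⟨ sumAll-*ˡ M bools ((- π) ^ n) (λ J → ⟦ J ≗ image c Q ⟧ * residue J) ⟩
    sumSubsets M (λ J → (- π) ^ n * (⟦ J ≗ image c Q ⟧ * residue J))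
      ≡⟨ sumAll-cong M bools (λ J → swap ((- π) ^ n) ⟦ J ≗ image c Q ⟧ (residue J)) ⟩
    sumSubsets M (λ J → ⟦ J ≗ image c Q ⟧ * (- π) ^ n * residue J) ∎
    where
    open ≡-Reasoning
    n = card k Q
    ∈bools : ∀ m → image c Q m ∈ bools
    ∈bools m with image c Q m
    ... | false = here refl
    ... | true  = there (here refl)
    swap : ∀ t a u → t * (a * u) ≡ a * t * u
    swap = solve 3 (λ t a u → t :* (a :* u) := a :* t :* u) refl
      where open +-*-Solver

  signedSum-expand : signedSum ≡ sumSubsets M (λ J → cellProduct J * residue J)
  signedSum-expand = begin
    sumSubsets k (λ Q → sign (card k Q) * 𝔖 (restrict k Q (e ∘ c)) q)
      ≡⟨ sumAll-cong k bools signedTerm ⟩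
    sumSubsets k (λ Q → sumSubsets M (λ J → ⟦ J ≗ image c Q ⟧ * (- π) ^ card k Q * residue J))
      ≡⟨ sumAll-comm k M bools bools _ ⟩
    sumSubsets M (λ J → sumSubsets k (λ Q → ⟦ J ≗ image c Q ⟧ * (- π) ^ card k Q * residue J))
      ≡⟨ sumAll-cong M bools (λ J → pull-residue J) ⟩
    sumSubsets M (λ J → imageWeight (- π) c J * residue J)
      ≡⟨ sumAll-cong M bools (λ J → cong (_* residue J) (imageWeight≡∏ (- π) c J)) ⟩
    sumSubsets M (λ J → cellProduct J * residue J) ∎
    where
    open ≡-Reasoning
    pull-residue : ∀ J → sumSubsets k (λ Q → ⟦ J ≗ image c Q ⟧ * (- π) ^ card k Q * residue J)
                         ≡ imageWeight (- π) c J * residue J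
    pull-residue J = trans (sumAll-cong k bools (λ Q → ℚP.*-comm _ (residue J)))
                       (trans (sym (sumAll-*ˡ k bools (residue J) _)) (ℚP.*-comm (residue J) _))

  cellSum-expand : 1 ℕ.≤ q → cellSum ≡ sumSubsets M (λ J → cellProduct J * residue J)
  cellSum-expand q≥1 = sumAll-cong M bools term
    where
    a : Fin M → ℚ
    a m = P (cellSize c m) (qOverφ q)
    factor : ∀ (J : Fin M → Bool) m →
             (if J m then π * a m else 1ℚ) ≡ cellFactor (- π) (J m) (cellSize c m)
    factor J m with J m
    ... | false = refl
    ... | true  = trans (cong (λ z → π * P (cellSize c m) z) (qOverφ≡eulerProduct q q≥1))
                        (z*P≡[1-z]^ℓ-1 (cellSize c m) π)
    term : ∀ J → prodOver M J a * 𝔖 (restrict M J e) q ≡ cellProduct J * residue J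
    term J = begin
      prodOver M J a * 𝔖 (restrict M J e) q
        ≡⟨ cong (prodOver M J a *_) (𝔖-restrict M J e q) ⟩
      prodOver M J a * (π ^ card M J * residue J)
        ≡⟨ sym (ℚP.*-assoc (prodOver M J a) (π ^ card M J) (residue J)) ⟩
      prodOver M J a * π ^ card M J * residue J
        ≡⟨ cong (_* residue J) (prodOver-*-^card M J a π) ⟩
      ∏ (λ m → if J m then π * a m else 1ℚ) * residue J
        ≡⟨ cong (_* residue J) (∏-cong {x = λ m → if J m then π * a m else 1ℚ} (factor J)) ⟩
      cellProduct J * residue J ∎
      where open ≡-Reasoning

  signedSum≡cellSum : 1 ℕ.≤ q → signedSum ≡ cellSum
  signedSum≡cellSum q≥1 = trans signedSum-expand (sym (cellSum-expand q≥1))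

open PartitionReindexing using (sumTuples-Δ)

lemma3p7 : (k h q M : ℕ) → k ≥ 1 → h ≥ 1 → q ≥ 1 →
    (c : Fin k → Fin M) → IsSurjective c →
    sumTuples k h (λ d → Δ c d * sumSubsets k (λ Q → sign (card k Q) * 𝔖 (restrict k Q d) q))
      ≡ sumTuples M h (λ d → sumSubsets M (λ J →
          prodOver M J (λ m → P (cellSize c m) (qOverφ q)) * 𝔖 (restrict M J d) q))
lemma3p7 k h q M _ _ q≥1 c surj =
  trans (sumTuples-Δ c surj h signedSum signedSum-cong)
        (sumAll-cong M (map suc (upTo h)) (λ e → FixedTuple.signedSum≡cellSum c q e q≥1))
  where
  signedSum : (Fin k → ℕ) → ℚ
  signedSum d = sumSubsets k (λ Q → sign (card k Q) * 𝔖 (restrict k Q d) q)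
  signedSum-cong : ∀ {d d′} → (∀ i → d i ≡ d′ i) → signedSum d ≡ signedSum d′
  signedSum-cong d≗d′ =
    sumAll-cong k bools (λ Q →
      cong (λ L → sign (card k Q) * 𝔖 L q) (restrict-cong k (λ _ → refl) d≗d′))
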